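{- Let $G$ be a finite connected weighted graph which is $N$-regular and bipartite with $V(G)=O\sqcup I$, and let $\tau$ be a non-trivial involution acting on $G$ as a weighted graph which interchanges $O$ and $I$. Let $G'=G/\langle\tau\rangle$ be the quotient weighted graph, $h$ its number of vertices, and $\delta,\delta'$ the weighted adjacency operators of $G,G'$. If $\lambda_1,\dots,\lambda_h$ are the eigenvalues of $\delta'$, then $\pm\lambda_1,\dots,\pm\lambda_h$ are the eigenvalues of $\delta$.
   Context: A graph $G$ consists of a set $V(G)$ of vertices, a set $E(G)$ of oriented edges, maps $e\mapsto(o(e),t(e))\in V(G)\times V(G)$ and $e\mapsto\bar e$ with $\bar{\bar e}=e$ and $t(\bar e)=o(e)$ (multiple edges, loops, and edges with $e=\bar e$ are allowed). A weighted graph has weight functions $w:E(G)\to\mathbb Z_{>0}$, $w:V(G)\to\mathbb Z_{>0}$ with $w(\bar e)=w(e)$. It is $N$-regular if $\sum_{e:\,t(e)=v}w(v)/w(e)=N$ for every vertex $v$. Bipartite means every edge has one extremity in $O$ and the other in $I$. A group acts on a weighted graph if it acts on $V(G)$ and $E(G)$ compatibly with $o$, bar, and weights. The quotient $G'=G/\langle\tau\rangle$ has vertices and edges the $\tau$-orbits, with weights $w(v')=w(v)$, $w(e')=w(e)$ for preimages $v,e$. The weighted adjacency operator on $C_0(G,\mathbb Q)$ (the $\mathbb Q$-vector space with basis $V(G)$) is $\delta(v)=\sum_{t(e)=v}\frac{w(v)}{w(e)}o(e)$. Eigenvalues are counted with multiplicity. -}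

module Defs where

open import Data.Nat as ℕ using (ℕ; zero; suc; NonZero)
open import Data.Integer as ℤ using (+_)
open import Data.Fin using (Fin; zero; suc; punchIn; toℕ)
open import Data.Fin.Properties using (_≟_)
open import Data.Bool using (Bool)
open import Data.List using (List; []; _∷_; map)
open import Data.Product using (Σ; ∃; _×_; _,_)
open import Data.Sum using (_⊎_)
open import Relation.Nullary using (¬_; yes; no)
open import Relation.Binary.PropositionalEquality using (_≡_)
open import Function.Bundles using (_⇔_)
open import Data.Rational as ℚ using (ℚ; 0ℚ; 1ℚ; -_; _/_)

-- Weighted graphs (Serre-style): finite vertex set Fin nV, finite
-- oriented edge set Fin nE, origin map o, reversal bar (involutive),
-- terminus t e := o (bar e)  (forced by t(ē) = o(e) and bar bar = id).

record WGraph : Set where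
  field
    nV nE    : ℕ
    o        : Fin nE → Fin nV
    bar      : Fin nE → Fin nE
    bar-inv  : ∀ e → bar (bar e) ≡ e
    wV       : Fin nV → ℕ
    wE       : Fin nE → ℕ
    wV-pos   : ∀ v → NonZero (wV v)
    wE-pos   : ∀ e → NonZero (wE e)
    wE-bar   : ∀ e → wE (bar e) ≡ wE e

  t : Fin nE → Fin nV
  t e = o (bar e)

open WGraph public

ΣFin : ∀ n → (Fin n → ℚ) → ℚ
ΣFin zero    f = 0ℚ
ΣFin (suc n) f = f zero ℚ.+ ΣFin n (λ i → f (suc i))

ratio : (G : WGraph) → Fin (nV G) → Fin (nE G) → ℚ
ratio G v e = _/_ (+ wV G v) (wE G e) {{wE-pos G e}}

data Path (G : WGraph) : Fin (nV G) → Fin (nV G) → Set where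
  here : ∀ {v} → Path G v v
  step : ∀ {w} (e : Fin (nE G)) → Path G (t G e) w → Path G (o G e) w

Connected : WGraph → Set
Connected G = ∀ u v → Path G u v

Regular : WGraph → ℕ → Set
Regular G N = ∀ v → ΣFin (nE G) (λ e → indicator e v) ≡ (+ N) / 1
  where
  indicator : Fin (nE G) → Fin (nV G) → ℚ
  indicator e v with t G e ≟ v
  ... | yes _ = ratio G v e
  ... | no  _ = 0ℚ

-- bipartition V = O ⊔ I given by side : V → Bool (O = true, I = false)
Bipartite : (G : WGraph) → (Fin (nV G) → Bool) → Set
Bipartite G side = ∀ e → ¬ (side (o G e) ≡ side (t G e))

record Involution (G : WGraph) : Set where
  field
    τV      : Fin (nV G) → Fin (nV G)
    τE      : Fin (nE G) → Fin (nE G)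
    τV-inv  : ∀ v → τV (τV v) ≡ v
    τE-inv  : ∀ e → τE (τE e) ≡ e
    τ-o     : ∀ e → o G (τE e) ≡ τV (o G e)
    τ-bar   : ∀ e → τE (bar G e) ≡ bar G (τE e)
    τ-wV    : ∀ v → wV G (τV v) ≡ wV G v
    τ-wE    : ∀ e → wE G (τE e) ≡ wE G e

open Involution public

NonTrivial : {G : WGraph} → Involution G → Set
NonTrivial τ = (∃ λ v → ¬ (τV τ v ≡ v)) ⊎ (∃ λ e → ¬ (τE τ e ≡ e))

-- G' is the quotient G/⟨τ⟩: vertices and edges of G' are (in bijection
-- with) the τ-orbits via the surjections πV, πE whose fibres are exactly
-- the orbits {x, τx}; o, bar and weights are induced.
record IsQuotient (G : WGraph) (τ : Involution G) (G' : WGraph) : Set where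
  field
    πV      : Fin (nV G) → Fin (nV G')
    πE      : Fin (nE G) → Fin (nE G')
    πV-surj : ∀ v' → ∃ λ v → πV v ≡ v'
    πE-surj : ∀ e' → ∃ λ e → πE e ≡ e'
    πV-fib  : ∀ x y → (πV x ≡ πV y) ⇔ ((y ≡ x) ⊎ (y ≡ τV τ x))
    πE-fib  : ∀ x y → (πE x ≡ πE y) ⇔ ((y ≡ x) ⊎ (y ≡ τE τ x))
    π-o     : ∀ e → o G' (πE e) ≡ πV (o G e)
    π-bar   : ∀ e → bar G' (πE e) ≡ πE (bar G e)
    π-wV    : ∀ v → wV G' (πV v) ≡ wV G v
    π-wE    : ∀ e → wE G' (πE e) ≡ wE G e

-- Weighted adjacency operator δ(v) = Σ_{t(e)=v} w(v)/w(e) · o(e),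
-- as a matrix: δ-entry u v = coefficient of u in δ(v).

δ-entry : (G : WGraph) → Fin (nV G) → Fin (nV G) → ℚ
δ-entry G u v = ΣFin (nE G) term
  where
  term : Fin (nE G) → ℚ
  term e with t G e ≟ v | o G e ≟ u
  ... | yes _ | yes _ = ratio G v e
  ... | _     | _     = 0ℚ

-- Polynomials over ℚ as coefficient lists (constant term first).

Poly : Set
Poly = List ℚ

_+P_ : Poly → Poly → Poly
[]      +P q       = q
(a ∷ p) +P []      = a ∷ p
(a ∷ p) +P (b ∷ q) = (a ℚ.+ b) ∷ (p +P q)

scaleP : ℚ → Poly → Poly
scaleP c p = map (c ℚ.*_) p

_*P_ : Poly → Poly → Poly
[]      *P q = []
(a ∷ p) *P q = scaleP a q +P (0ℚ ∷ (p *P q))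

-- p(x) ↦ p(-x)
negArg : Poly → Poly
negArg []      = []
negArg (a ∷ p) = a ∷ scaleP (- 1ℚ) (negArg p)

coeff : Poly → ℕ → ℚ
coeff []      _       = 0ℚ
coeff (a ∷ p) zero    = a
coeff (a ∷ p) (suc i) = coeff p i

-- equality of polynomials (ignores trailing zero coefficients)
_≈P_ : Poly → Poly → Set
p ≈P q = ∀ i → coeff p i ≡ coeff q i

ΣP : ∀ n → (Fin n → Poly) → Poly
ΣP zero    f = []
ΣP (suc n) f = f zero +P ΣP n (λ i → f (suc i))

sign : ℕ → ℚ
sign zero    = 1ℚ
sign (suc k) = - sign k

det : ∀ n → (Fin n → Fin n → Poly) → Poly
det zero    A = 1ℚ ∷ []
det (suc n) A = ΣP (suc n) λ j →
  scaleP (sign (toℕ j)) (A zero j *P det n (λ i k → A (suc i) (punchIn j k)))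

charPoly : ∀ n → (Fin n → Fin n → ℚ) → Poly
charPoly n M = det n entry
  where
  entry : Fin n → Fin n → Poly
  entry i j with i ≟ j
  ... | yes _ = (- M i j) ∷ 1ℚ ∷ []
  ... | no  _ = (- M i j) ∷ []

χδ : WGraph → Poly
χδ G = charPoly (nV G) (δ-entry G)

{-# OPTIONS --safe #-}

-- Order the vertices of G as v₁, …, v_h, τv₁, …, τv_h, where vᵢ is the preimage in O of the
-- i-th vertex of G′. Bipartiteness makes the two diagonal blocks of δ vanish, and the
-- τ-invariance of δ together with the description of the edges of G′ as τ-orbits makes both
-- off-diagonal blocks equal to the matrix A of δ′. So x·1 − δ = [[x·1, −A], [−A, x·1]], whose
-- determinant is det(x·1 − A) · det(x·1 + A) by block row and column operations, and
-- det(x·1 + A) = (−1)^h χ_δ′(−x).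

module Submission where

open import Defs hiding (det)

open import Algebra.Bundles using (CommutativeRing)
open import Data.Bool using (Bool; true; false; not)
open import Data.Bool.Properties using (¬-not)
open import Data.Empty using (⊥-elim)
open import Data.Fin as Fin using (Fin; zero; suc; toℕ; punchIn; punchOut; _↑ˡ_; _↑ʳ_; splitAt)
open import Data.Fin.Properties using (_≟_)
import Data.Fin.Properties as Finₚ
open import Data.Fin.Permutation.Components using (transpose; transpose-inverse)
open import Data.Integer using (+_)
open import Data.List using ([]; _∷_)
open import Data.Nat as ℕ using (ℕ; zero; suc)
import Data.Nat.Properties as ℕₚ
open import Data.Product using (_×_; _,_; proj₁; proj₂; ∃)
open import Data.Rational as ℚ using (ℚ; 0ℚ; 1ℚ)
import Data.Rational.Properties as ℚₚ
open import Data.Sum using (_⊎_; inj₁; inj₂; [_,_]′)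
import Data.Vec.Functional as Vector
open import Data.Vec.Functional using (updateAt)
open import Data.Vec.Functional.Properties using (updateAt-updates; updateAt-minimal)
open import Function using (_∘_; const)
open import Function.Bundles using (Equivalence)
open import Function.Definitions using (Injective)
open import Level using (0ℓ)
open import Relation.Binary.Bundles using (Setoid)
open import Relation.Binary.Definitions using (tri<; tri≈; tri>)
open import Relation.Binary.PropositionalEquality as ≡ using (_≡_; _≢_; refl; cong; cong₂)
import Relation.Binary.Reasoning.Setoid
open import Relation.Binary.Structures using (IsEquivalence)
open import Relation.Nullary using (¬_; Dec; yes; no)

module Polynomial where

  open CommutativeRing ℚₚ.+-*-commutativeRing using (ring; +-commutativeSemigroup; *-commutativeSemigroup)
  open import Algebra.Properties.Ring ring using (-1*x≈-x)
  open import Algebra.Properties.CommutativeSemigroup +-commutativeSemigroup using (interchange)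
  open import Algebra.Properties.CommutativeSemigroup *-commutativeSemigroup using (x∙yz≈y∙xz)
  open ≡.≡-Reasoning

  -- A record rather than Defs._≈P_, so that both polynomials can be inferred from a proof.
  infix 4 _≋_
  record _≋_ (p q : Poly) : Set where
    constructor mk≋
    field coeff-≡ : ∀ i → coeff p i ≡ coeff q i
  open _≋_ public

  ≋-isEquivalence : IsEquivalence _≋_
  ≋-isEquivalence = record
    { refl  = mk≋ λ _ → refl
    ; sym   = λ p≋q → mk≋ λ i → ≡.sym (coeff-≡ p≋q i)
    ; trans = λ p≋q q≋r → mk≋ λ i → ≡.trans (coeff-≡ p≋q i) (coeff-≡ q≋r i)
    }

  open IsEquivalence ≋-isEquivalence public
    using () renaming (refl to ≋-refl; sym to ≋-sym; trans to ≋-trans; reflexive to ≋-reflexive)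

  ≋-setoid : Setoid 0ℓ 0ℓ
  ≋-setoid = record { isEquivalence = ≋-isEquivalence }

  module ≋-Reasoning = Relation.Binary.Reasoning.Setoid ≋-setoid

  infix 25 -P_
  -P_ : Poly → Poly
  -P p = scaleP (ℚ.- 1ℚ) p

  coeff-+P : ∀ p q i → coeff (p +P q) i ≡ coeff p i ℚ.+ coeff q i
  coeff-+P []      q       i       = ≡.sym (ℚₚ.+-identityˡ _)
  coeff-+P (a ∷ p) []      i       = ≡.sym (ℚₚ.+-identityʳ _)
  coeff-+P (a ∷ p) (b ∷ q) zero    = refl
  coeff-+P (a ∷ p) (b ∷ q) (suc i) = coeff-+P p q i

  coeff-scaleP : ∀ c p i → coeff (scaleP c p) i ≡ c ℚ.* coeff p i
  coeff-scaleP c []      i       = ≡.sym (ℚₚ.*-zeroʳ c)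
  coeff-scaleP c (a ∷ p) zero    = refl
  coeff-scaleP c (a ∷ p) (suc i) = coeff-scaleP c p i

  coeff--P : ∀ p i → coeff (-P p) i ≡ ℚ.- coeff p i
  coeff--P p i = ≡.trans (coeff-scaleP (ℚ.- 1ℚ) p i) (-1*x≈-x (coeff p i))

  ∷-cong : ∀ {a b p q} → a ≡ b → p ≋ q → a ∷ p ≋ b ∷ q
  ∷-cong a≡b p≋q = mk≋ λ { zero → a≡b ; (suc i) → coeff-≡ p≋q i }

  0∷[]≋[] : 0ℚ ∷ [] ≋ []
  0∷[]≋[] = mk≋ λ { zero → refl ; (suc i) → refl }

  +P-cong : ∀ {p p′ q q′} → p ≋ p′ → q ≋ q′ → p +P q ≋ p′ +P q′
  +P-cong {p} {p′} {q} {q′} p≋p′ q≋q′ = mk≋ λ i → begin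
    coeff (p +P q) i          ≡⟨ coeff-+P p q i ⟩
    coeff p i ℚ.+ coeff q i   ≡⟨ cong₂ ℚ._+_ (coeff-≡ p≋p′ i) (coeff-≡ q≋q′ i) ⟩
    coeff p′ i ℚ.+ coeff q′ i ≡⟨ coeff-+P p′ q′ i ⟨
    coeff (p′ +P q′) i        ∎

  scaleP-cong : ∀ c {p q} → p ≋ q → scaleP c p ≋ scaleP c q
  scaleP-cong c {p} {q} p≋q = mk≋ λ i → begin
    coeff (scaleP c p) i ≡⟨ coeff-scaleP c p i ⟩
    c ℚ.* coeff p i      ≡⟨ cong (c ℚ.*_) (coeff-≡ p≋q i) ⟩
    c ℚ.* coeff q i      ≡⟨ coeff-scaleP c q i ⟨
    coeff (scaleP c q) i ∎

  +P-comm : ∀ p q → p +P q ≋ q +P p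
  +P-comm p q = mk≋ λ i → begin
    coeff (p +P q) i        ≡⟨ coeff-+P p q i ⟩
    coeff p i ℚ.+ coeff q i ≡⟨ ℚₚ.+-comm (coeff p i) (coeff q i) ⟩
    coeff q i ℚ.+ coeff p i ≡⟨ coeff-+P q p i ⟨
    coeff (q +P p) i        ∎

  +P-assoc : ∀ p q r → (p +P q) +P r ≋ p +P (q +P r)
  +P-assoc p q r = mk≋ λ i → begin
    coeff ((p +P q) +P r) i                   ≡⟨ ≡.trans (coeff-+P (p +P q) r i) (cong (ℚ._+ coeff r i) (coeff-+P p q i)) ⟩
    (coeff p i ℚ.+ coeff q i) ℚ.+ coeff r i   ≡⟨ ℚₚ.+-assoc (coeff p i) (coeff q i) (coeff r i) ⟩
    coeff p i ℚ.+ (coeff q i ℚ.+ coeff r i)   ≡⟨ ≡.trans (coeff-+P p (q +P r) i) (cong (coeff p i ℚ.+_) (coeff-+P q r i)) ⟨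
    coeff (p +P (q +P r)) i                   ∎

  +P-interchange : ∀ p q r s → (p +P q) +P (r +P s) ≋ (p +P r) +P (q +P s)
  +P-interchange p q r s = mk≋ λ i → begin
    coeff ((p +P q) +P (r +P s)) i
      ≡⟨ ≡.trans (coeff-+P (p +P q) (r +P s) i) (cong₂ ℚ._+_ (coeff-+P p q i) (coeff-+P r s i)) ⟩
    (coeff p i ℚ.+ coeff q i) ℚ.+ (coeff r i ℚ.+ coeff s i)
      ≡⟨ interchange (coeff p i) (coeff q i) (coeff r i) (coeff s i) ⟩
    (coeff p i ℚ.+ coeff r i) ℚ.+ (coeff q i ℚ.+ coeff s i)
      ≡⟨ ≡.trans (coeff-+P (p +P r) (q +P s) i) (cong₂ ℚ._+_ (coeff-+P p r i) (coeff-+P q s i)) ⟨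
    coeff ((p +P r) +P (q +P s)) i
      ∎

  +P-identityʳ : ∀ p → p +P [] ≋ p
  +P-identityʳ []      = ≋-refl
  +P-identityʳ (a ∷ p) = ≋-refl

  +P-inverseʳ : ∀ p → p +P -P p ≋ []
  +P-inverseʳ p = mk≋ λ i → begin
    coeff (p +P -P p) i         ≡⟨ coeff-+P p (-P p) i ⟩
    coeff p i ℚ.+ coeff (-P p) i ≡⟨ cong (coeff p i ℚ.+_) (coeff--P p i) ⟩
    coeff p i ℚ.- coeff p i     ≡⟨ ℚₚ.+-inverseʳ (coeff p i) ⟩
    0ℚ                          ∎

  +P-shift : ∀ p q → (0ℚ ∷ p) +P (0ℚ ∷ q) ≋ 0ℚ ∷ (p +P q)
  +P-shift p q = ∷-cong (ℚₚ.+-identityˡ 0ℚ) ≋-refl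

  scaleP-distrib-+P : ∀ c p q → scaleP c (p +P q) ≋ scaleP c p +P scaleP c q
  scaleP-distrib-+P c p q = mk≋ λ i → begin
    coeff (scaleP c (p +P q)) i                   ≡⟨ ≡.trans (coeff-scaleP c (p +P q) i) (cong (c ℚ.*_) (coeff-+P p q i)) ⟩
    c ℚ.* (coeff p i ℚ.+ coeff q i)               ≡⟨ ℚₚ.*-distribˡ-+ c (coeff p i) (coeff q i) ⟩
    c ℚ.* coeff p i ℚ.+ c ℚ.* coeff q i           ≡⟨ ≡.trans (coeff-+P (scaleP c p) (scaleP c q) i)
                                                             (cong₂ ℚ._+_ (coeff-scaleP c p i) (coeff-scaleP c q i)) ⟨
    coeff (scaleP c p +P scaleP c q) i            ∎

  scaleP-distribʳ-+ : ∀ c d p → scaleP (c ℚ.+ d) p ≋ scaleP c p +P scaleP d p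
  scaleP-distribʳ-+ c d p = mk≋ λ i → begin
    coeff (scaleP (c ℚ.+ d) p) i                  ≡⟨ coeff-scaleP (c ℚ.+ d) p i ⟩
    (c ℚ.+ d) ℚ.* coeff p i                       ≡⟨ ℚₚ.*-distribʳ-+ (coeff p i) c d ⟩
    c ℚ.* coeff p i ℚ.+ d ℚ.* coeff p i           ≡⟨ ≡.trans (coeff-+P (scaleP c p) (scaleP d p) i)
                                                             (cong₂ ℚ._+_ (coeff-scaleP c p i) (coeff-scaleP d p i)) ⟨
    coeff (scaleP c p +P scaleP d p) i            ∎

  scaleP-scaleP : ∀ c d p → scaleP c (scaleP d p) ≋ scaleP (c ℚ.* d) p
  scaleP-scaleP c d p = mk≋ λ i → begin
    coeff (scaleP c (scaleP d p)) i ≡⟨ ≡.trans (coeff-scaleP c (scaleP d p) i) (cong (c ℚ.*_) (coeff-scaleP d p i)) ⟩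
    c ℚ.* (d ℚ.* coeff p i)         ≡⟨ ℚₚ.*-assoc c d (coeff p i) ⟨
    (c ℚ.* d) ℚ.* coeff p i         ≡⟨ coeff-scaleP (c ℚ.* d) p i ⟨
    coeff (scaleP (c ℚ.* d) p) i    ∎

  scaleP-zero : ∀ p → scaleP 0ℚ p ≋ []
  scaleP-zero p = mk≋ λ i → ≡.trans (coeff-scaleP 0ℚ p i) (ℚₚ.*-zeroˡ (coeff p i))

  scaleP-identity : ∀ p → scaleP 1ℚ p ≋ p
  scaleP-identity p = mk≋ λ i → ≡.trans (coeff-scaleP 1ℚ p i) (ℚₚ.*-identityˡ (coeff p i))

  coeff-negArg : ∀ p i → coeff (negArg p) i ≡ sign i ℚ.* coeff p i
  coeff-negArg []      i       = ≡.sym (ℚₚ.*-zeroʳ (sign i))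
  coeff-negArg (a ∷ p) zero    = ≡.sym (ℚₚ.*-identityˡ a)
  coeff-negArg (a ∷ p) (suc i) = begin
    coeff (-P negArg p) i          ≡⟨ coeff--P (negArg p) i ⟩
    ℚ.- coeff (negArg p) i         ≡⟨ cong ℚ.-_ (coeff-negArg p i) ⟩
    ℚ.- (sign i ℚ.* coeff p i)     ≡⟨ ℚₚ.neg-distribˡ-* (sign i) (coeff p i) ⟩
    ℚ.- sign i ℚ.* coeff p i       ∎

  negArg-cong : ∀ {p q} → p ≋ q → negArg p ≋ negArg q
  negArg-cong {p} {q} p≋q = mk≋ λ i → begin
    coeff (negArg p) i        ≡⟨ coeff-negArg p i ⟩
    sign i ℚ.* coeff p i      ≡⟨ cong (sign i ℚ.*_) (coeff-≡ p≋q i) ⟩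
    sign i ℚ.* coeff q i      ≡⟨ coeff-negArg q i ⟨
    coeff (negArg q) i        ∎

  negArg-+P : ∀ p q → negArg (p +P q) ≋ negArg p +P negArg q
  negArg-+P p q = mk≋ λ i → begin
    coeff (negArg (p +P q)) i
      ≡⟨ ≡.trans (coeff-negArg (p +P q) i) (cong (sign i ℚ.*_) (coeff-+P p q i)) ⟩
    sign i ℚ.* (coeff p i ℚ.+ coeff q i)
      ≡⟨ ℚₚ.*-distribˡ-+ (sign i) (coeff p i) (coeff q i) ⟩
    sign i ℚ.* coeff p i ℚ.+ sign i ℚ.* coeff q i
      ≡⟨ ≡.trans (coeff-+P (negArg p) (negArg q) i) (cong₂ ℚ._+_ (coeff-negArg p i) (coeff-negArg q i)) ⟨
    coeff (negArg p +P negArg q) i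
      ∎

  negArg-scaleP : ∀ c p → negArg (scaleP c p) ≋ scaleP c (negArg p)
  negArg-scaleP c p = mk≋ λ i → begin
    coeff (negArg (scaleP c p)) i
      ≡⟨ ≡.trans (coeff-negArg (scaleP c p) i) (cong (sign i ℚ.*_) (coeff-scaleP c p i)) ⟩
    sign i ℚ.* (c ℚ.* coeff p i)
      ≡⟨ x∙yz≈y∙xz (sign i) c (coeff p i) ⟩
    c ℚ.* (sign i ℚ.* coeff p i)
      ≡⟨ ≡.trans (coeff-scaleP c (negArg p) i) (cong (c ℚ.*_) (coeff-negArg p i)) ⟨
    coeff (scaleP c (negArg p)) i
      ∎

module PolynomialRing where

  open Polynomial
  open ≋-Reasoning

  ≋-[] : ∀ {a p} → a ∷ p ≋ [] → (a ≡ 0ℚ) × (p ≋ [])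
  ≋-[] a∷p≋[] = coeff-≡ a∷p≋[] zero , mk≋ λ i → coeff-≡ a∷p≋[] (suc i)

  ≋[]-*P : ∀ {p} q → p ≋ [] → p *P q ≋ []
  ≋[]-*P {[]}    q p≋[] = ≋-refl
  ≋[]-*P {a ∷ p} q a∷p≋[] with ≋-[] a∷p≋[]
  ... | refl , p≋[] = ≋-trans (+P-cong (scaleP-zero q) (∷-cong refl (≋[]-*P q p≋[]))) 0∷[]≋[]

  *P-congˡ : ∀ {p p′} q → p ≋ p′ → p *P q ≋ p′ *P q
  *P-congˡ {[]}    {p′}     q p≋p′ = ≋-sym (≋[]-*P q (≋-sym p≋p′))
  *P-congˡ {a ∷ p} {[]}     q p≋p′ = ≋[]-*P q p≋p′
  *P-congˡ {a ∷ p} {b ∷ p′} q p≋p′ = +P-cong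
    (≋-reflexive (cong (λ c → scaleP c q) (coeff-≡ p≋p′ zero)))
    (∷-cong refl (*P-congˡ {p} {p′} q (mk≋ λ i → coeff-≡ p≋p′ (suc i))))

  *P-congʳ : ∀ p {q q′} → q ≋ q′ → p *P q ≋ p *P q′
  *P-congʳ []      q≋q′ = ≋-refl
  *P-congʳ (a ∷ p) q≋q′ = +P-cong (scaleP-cong a q≋q′) (∷-cong refl (*P-congʳ p q≋q′))

  *P-cong : ∀ {p p′ q q′} → p ≋ p′ → q ≋ q′ → p *P q ≋ p′ *P q′
  *P-cong {p} {p′} {q} p≋p′ q≋q′ = ≋-trans (*P-congˡ q p≋p′) (*P-congʳ p′ q≋q′)

  *P-distribʳ-+P : ∀ p q r → (p +P q) *P r ≋ (p *P r) +P (q *P r)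
  *P-distribʳ-+P []      q       r = ≋-refl
  *P-distribʳ-+P (a ∷ p) []      r = ≋-sym (+P-identityʳ _)
  *P-distribʳ-+P (a ∷ p) (b ∷ q) r = begin
    scaleP (a ℚ.+ b) r +P (0ℚ ∷ ((p +P q) *P r))
      ≈⟨ +P-cong (scaleP-distribʳ-+ a b r) (∷-cong refl (*P-distribʳ-+P p q r)) ⟩
    (scaleP a r +P scaleP b r) +P (0ℚ ∷ ((p *P r) +P (q *P r)))
      ≈⟨ +P-cong ≋-refl (+P-shift (p *P r) (q *P r)) ⟨
    (scaleP a r +P scaleP b r) +P ((0ℚ ∷ (p *P r)) +P (0ℚ ∷ (q *P r)))
      ≈⟨ +P-interchange (scaleP a r) (scaleP b r) (0ℚ ∷ (p *P r)) (0ℚ ∷ (q *P r)) ⟩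
    (scaleP a r +P (0ℚ ∷ (p *P r))) +P (scaleP b r +P (0ℚ ∷ (q *P r)))
      ∎

  *P-distribˡ-+P : ∀ p q r → p *P (q +P r) ≋ (p *P q) +P (p *P r)
  *P-distribˡ-+P []      q r = ≋-refl
  *P-distribˡ-+P (a ∷ p) q r = begin
    scaleP a (q +P r) +P (0ℚ ∷ (p *P (q +P r)))
      ≈⟨ +P-cong (scaleP-distrib-+P a q r) (∷-cong refl (*P-distribˡ-+P p q r)) ⟩
    (scaleP a q +P scaleP a r) +P (0ℚ ∷ ((p *P q) +P (p *P r)))
      ≈⟨ +P-cong ≋-refl (+P-shift (p *P q) (p *P r)) ⟨
    (scaleP a q +P scaleP a r) +P ((0ℚ ∷ (p *P q)) +P (0ℚ ∷ (p *P r)))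
      ≈⟨ +P-interchange (scaleP a q) (scaleP a r) (0ℚ ∷ (p *P q)) (0ℚ ∷ (p *P r)) ⟩
    (scaleP a q +P (0ℚ ∷ (p *P q))) +P (scaleP a r +P (0ℚ ∷ (p *P r)))
      ∎

  shift-*P : ∀ p q → (0ℚ ∷ p) *P q ≋ 0ℚ ∷ (p *P q)
  shift-*P p q = +P-cong (scaleP-zero q) ≋-refl

  *P-shift : ∀ p q → p *P (0ℚ ∷ q) ≋ 0ℚ ∷ (p *P q)
  *P-shift []      q = ≋-sym 0∷[]≋[]
  *P-shift (a ∷ p) q = ≋-trans
    (+P-cong (∷-cong (ℚₚ.*-zeroʳ a) ≋-refl) (∷-cong refl (*P-shift p q)))
    (+P-shift (scaleP a q) (0ℚ ∷ (p *P q)))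

  scaleP-*P : ∀ c p q → scaleP c p *P q ≋ scaleP c (p *P q)
  scaleP-*P c []      q = ≋-refl
  scaleP-*P c (a ∷ p) q = begin
    scaleP (c ℚ.* a) q +P (0ℚ ∷ (scaleP c p *P q))
      ≈⟨ +P-cong (scaleP-scaleP c a q) (∷-cong refl (≋-sym (scaleP-*P c p q))) ⟨
    scaleP c (scaleP a q) +P (0ℚ ∷ scaleP c (p *P q))
      ≈⟨ +P-cong ≋-refl (∷-cong (ℚₚ.*-zeroʳ c) ≋-refl) ⟨
    scaleP c (scaleP a q) +P scaleP c (0ℚ ∷ (p *P q))
      ≈⟨ scaleP-distrib-+P c (scaleP a q) (0ℚ ∷ (p *P q)) ⟨
    scaleP c (scaleP a q +P (0ℚ ∷ (p *P q)))
      ∎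

  *P-assoc : ∀ p q r → (p *P q) *P r ≋ p *P (q *P r)
  *P-assoc []      q r = ≋-refl
  *P-assoc (a ∷ p) q r = begin
    (scaleP a q +P (0ℚ ∷ (p *P q))) *P r
      ≈⟨ *P-distribʳ-+P (scaleP a q) (0ℚ ∷ (p *P q)) r ⟩
    (scaleP a q *P r) +P ((0ℚ ∷ (p *P q)) *P r)
      ≈⟨ +P-cong (scaleP-*P a q r) (shift-*P (p *P q) r) ⟩
    scaleP a (q *P r) +P (0ℚ ∷ ((p *P q) *P r))
      ≈⟨ +P-cong ≋-refl (∷-cong refl (*P-assoc p q r)) ⟩
    scaleP a (q *P r) +P (0ℚ ∷ (p *P (q *P r)))
      ∎

  *P-zeroʳ : ∀ p → p *P [] ≋ []
  *P-zeroʳ []      = ≋-refl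
  *P-zeroʳ (a ∷ p) = ≋-trans (∷-cong refl (*P-zeroʳ p)) 0∷[]≋[]

  *P-constʳ : ∀ p a → p *P (a ∷ []) ≋ scaleP a p
  *P-constʳ []      a = ≋-refl
  *P-constʳ (b ∷ p) a = ∷-cong (≡.trans (ℚₚ.+-identityʳ _) (ℚₚ.*-comm b a)) (*P-constʳ p a)

  *P-∷ : ∀ p a q → p *P (a ∷ q) ≋ scaleP a p +P (0ℚ ∷ (p *P q))
  *P-∷ p a q = begin
    p *P (a ∷ q)                          ≈⟨ *P-congʳ p (∷-cong (≡.sym (ℚₚ.+-identityʳ a)) ≋-refl) ⟩
    p *P ((a ∷ []) +P (0ℚ ∷ q))           ≈⟨ *P-distribˡ-+P p (a ∷ []) (0ℚ ∷ q) ⟩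
    (p *P (a ∷ [])) +P (p *P (0ℚ ∷ q))    ≈⟨ +P-cong (*P-constʳ p a) (*P-shift p q) ⟩
    scaleP a p +P (0ℚ ∷ (p *P q))         ∎

  *P-comm : ∀ p q → p *P q ≋ q *P p
  *P-comm []      q = ≋-sym (*P-zeroʳ q)
  *P-comm (a ∷ p) q = ≋-trans (+P-cong ≋-refl (∷-cong refl (*P-comm p q))) (≋-sym (*P-∷ q a p))

  1P : Poly
  1P = 1ℚ ∷ []

  *P-identityˡ : ∀ p → 1P *P p ≋ p
  *P-identityˡ p = ≋-trans (+P-cong (scaleP-identity p) 0∷[]≋[]) (+P-identityʳ p)

  *P-identityʳ : ∀ p → p *P 1P ≋ p
  *P-identityʳ p = ≋-trans (*P-comm p 1P) (*P-identityˡ p)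

  commutativeRing : CommutativeRing 0ℓ 0ℓ
  commutativeRing = record
    { Carrier = Poly ; _≈_ = _≋_ ; _+_ = _+P_ ; _*_ = _*P_ ; -_ = -P_ ; 0# = [] ; 1# = 1P
    ; isCommutativeRing = record
      { isRing = record
        { +-isAbelianGroup = record
          { isGroup = record
            { isMonoid = record
              { isSemigroup = record
                { isMagma = record { isEquivalence = ≋-isEquivalence ; ∙-cong = +P-cong }
                ; assoc = +P-assoc }
              ; identity = (λ _ → ≋-refl) , +P-identityʳ }
            ; inverse = (λ p → ≋-trans (+P-comm (-P p) p) (+P-inverseʳ p)) , +P-inverseʳ
            ; ⁻¹-cong = scaleP-cong (ℚ.- 1ℚ) }
          ; comm = +P-comm }
        ; *-cong = *P-cong
        ; *-assoc = *P-assoc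
        ; *-identity = *P-identityˡ , *P-identityʳ
        ; distrib = *P-distribˡ-+P , λ p q r → *P-distribʳ-+P q r p }
      ; *-comm = *P-comm } }


  negArg-*P : ∀ p q → negArg (p *P q) ≋ negArg p *P negArg q
  negArg-*P []      q = ≋-refl
  negArg-*P (a ∷ p) q = begin
    negArg (scaleP a q +P (0ℚ ∷ (p *P q)))
      ≈⟨ negArg-+P (scaleP a q) (0ℚ ∷ (p *P q)) ⟩
    negArg (scaleP a q) +P (0ℚ ∷ -P negArg (p *P q))
      ≈⟨ +P-cong (negArg-scaleP a q) (∷-cong refl (scaleP-cong (ℚ.- 1ℚ) (negArg-*P p q))) ⟩
    scaleP a (negArg q) +P (0ℚ ∷ -P (negArg p *P negArg q))
      ≈⟨ +P-cong ≋-refl (∷-cong refl (scaleP-*P (ℚ.- 1ℚ) (negArg p) (negArg q))) ⟨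
    scaleP a (negArg q) +P (0ℚ ∷ ((-P negArg p) *P negArg q))
      ∎

module FinProperties where

  open import Relation.Nullary.Decidable using (dec-true; dec-false)

  transpose-ˡ : ∀ {n} (i j : Fin n) → transpose i j i ≡ j
  transpose-ˡ i j rewrite dec-true (i ≟ i) refl = refl

  transpose-ʳ : ∀ {n} (i j : Fin n) → transpose i j j ≡ i
  transpose-ʳ i j with j ≟ i
  ... | yes j≡i = j≡i
  ... | no _ rewrite dec-true (j ≟ j) refl = refl

  transpose-≢ : ∀ {n} {i j k : Fin n} → k ≢ i → k ≢ j → transpose i j k ≡ k
  transpose-≢ {i = i} {j} {k} k≢i k≢j rewrite dec-false (k ≟ i) k≢i | dec-false (k ≟ j) k≢j = refl

  missing⇒collision : ∀ {n} (f : Fin n → Fin n) c → (∀ j → f j ≢ c) →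
                      ∃ λ i → ∃ λ i′ → i ≢ i′ × f i ≡ f i′
  missing⇒collision {suc n} f c f≢c with Finₚ.pigeonhole (ℕₚ.n<1+n n) (λ i → punchOut (f≢c i ∘ ≡.sym))
  ... | i , i′ , i<i′ , eq = i , i′ , Finₚ.<⇒≢ i<i′ , Finₚ.punchOut-injective (f≢c i ∘ ≡.sym) (f≢c i′ ∘ ≡.sym) eq

  ↑ˡ≢↑ʳ : ∀ {m n} (i : Fin m) (j : Fin n) → i ↑ˡ n ≢ m ↑ʳ j
  ↑ˡ≢↑ʳ {m} {n} i j eq with ≡.trans (≡.sym (Finₚ.splitAt-↑ˡ m i n)) (≡.trans (cong (splitAt m) eq) (Finₚ.splitAt-↑ʳ m n j))
  ... | ()

  punchIn-↑ˡ : ∀ {h} k (j : Fin (suc h)) (l : Fin h) → punchIn (j ↑ˡ k) (l ↑ˡ k) ≡ punchIn j l ↑ˡ k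
  punchIn-↑ˡ k zero    l       = refl
  punchIn-↑ˡ k (suc j) zero    = refl
  punchIn-↑ˡ k (suc j) (suc l) = cong suc (punchIn-↑ˡ k j l)

  punchIn-↑ʳ : ∀ {h} k (j : Fin (suc h)) (l : Fin k) → punchIn (j ↑ˡ k) (h ↑ʳ l) ≡ suc h ↑ʳ l
  punchIn-↑ʳ k zero    l = refl
  punchIn-↑ʳ {suc h} k (suc j) l = cong suc (punchIn-↑ʳ k j l)

  punchOut-adjacent : ∀ {n} {i a b : Fin (suc n)} (i≢a : i ≢ a) (i≢b : i ≢ b) →
                      toℕ b ≡ suc (toℕ a) → toℕ (punchOut i≢b) ≡ suc (toℕ (punchOut i≢a))
  punchOut-adjacent {i = zero}  {zero}  i≢a i≢b b≡1+a = ⊥-elim (i≢a refl)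
  punchOut-adjacent {i = zero}  {suc a} {zero}  i≢a i≢b ()
  punchOut-adjacent {i = zero}  {suc a} {suc b} i≢a i≢b b≡1+a = ℕₚ.suc-injective b≡1+a
  punchOut-adjacent {suc n} {suc i} {zero}  {zero}  i≢a i≢b ()
  punchOut-adjacent {suc n} {suc zero} {zero} {suc zero} i≢a i≢b b≡1+a = ⊥-elim (i≢b refl)
  punchOut-adjacent {suc (suc n)} {suc (suc i)} {zero} {suc zero} i≢a i≢b b≡1+a = refl
  punchOut-adjacent {suc n} {suc i} {zero}  {suc (suc b)} i≢a i≢b ()
  punchOut-adjacent {suc n} {suc i} {suc a} {zero}  i≢a i≢b ()
  punchOut-adjacent {suc n} {suc i} {suc a} {suc b} i≢a i≢b b≡1+a =
    cong suc (punchOut-adjacent (i≢a ∘ cong suc) (i≢b ∘ cong suc) (ℕₚ.suc-injective b≡1+a))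

  punchIn-adjacent : ∀ {n} (a b : Fin (suc n)) → toℕ b ≡ suc (toℕ a) → ∀ k →
                     punchIn a k ≡ punchIn b k ⊎ (punchIn a k ≡ b × punchIn b k ≡ a)
  punchIn-adjacent zero    zero          () k
  punchIn-adjacent zero    (suc zero)    _  zero    = inj₂ (refl , refl)
  punchIn-adjacent zero    (suc zero)    _  (suc k) = inj₁ refl
  punchIn-adjacent zero    (suc (suc b)) () k
  punchIn-adjacent (suc a) zero          () k
  punchIn-adjacent (suc a) (suc b)       _  zero    = inj₁ refl
  punchIn-adjacent (suc a) (suc b) b≡1+a (suc k) with punchIn-adjacent a b (ℕₚ.suc-injective b≡1+a) k
  ... | inj₁ eq          = inj₁ (cong suc eq)
  ... | inj₂ (eq₁ , eq₂) = inj₂ (cong suc eq₁ , cong suc eq₂)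

module Determinant {ℓ₁ ℓ₂} (R : CommutativeRing ℓ₁ ℓ₂) where

  open CommutativeRing R renaming (refl to ≈-refl) hiding (zero)
  open import Algebra.Properties.Ring ring
    using (-1*x≈-x; -‿distribˡ-*; -‿distribʳ-*; -‿involutive; +-inverseʳ-unique; -0#≈0#; ⁻¹-anti-homo‿-)
  open import Algebra.Properties.Semiring.Sum semiring
    using (sum; sum-syntax; sum-cong-≋; sum-replicate-zero; sum-remove; ∑-comm; *-distribˡ-sum; *-distribʳ-sum)
  open import Algebra.Properties.CommutativeSemigroup *-commutativeSemigroup using (x∙yz≈y∙xz)
  open import Algebra.Definitions.RawMonoid *-rawMonoid using () renaming (sum to product)
  open import Relation.Binary.Reasoning.Setoid setoid
  open FinProperties

  sum-zero : ∀ n {f : Fin n → Carrier} → (∀ i → f i ≈ 0#) → sum f ≈ 0#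
  sum-zero n f≈0 = trans (sum-cong-≋ f≈0) (sum-replicate-zero n)

  sum-single : ∀ {n} (f : Fin n → Carrier) i → (∀ j → j ≢ i → f j ≈ 0#) → sum f ≈ f i
  sum-single {suc n} f i f≈0 = begin
    sum f                                      ≈⟨ sum-remove f ⟩
    f i + sum (λ k → f (punchIn i k))          ≈⟨ +-congˡ (sum-zero n λ k → f≈0 _ (Finₚ.punchInᵢ≢i i k)) ⟩
    f i + 0#                                   ≈⟨ +-identityʳ (f i) ⟩
    f i                                        ∎

  sum-pair : ∀ {n} (f : Fin n → Carrier) {i j} → i ≢ j → (∀ k → k ≢ i → k ≢ j → f k ≈ 0#) → sum f ≈ f i + f j
  sum-pair {suc n} f {i} {j} i≢j f≈0 = begin
    sum f                                        ≈⟨ sum-remove f ⟩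
    f i + sum (λ k → f (punchIn i k))            ≈⟨ +-congˡ (sum-single _ (punchOut i≢j) vanish) ⟩
    f i + f (punchIn i (punchOut i≢j))           ≡⟨ cong (λ k → f i + f k) (Finₚ.punchIn-punchOut i≢j) ⟩
    f i + f j                                    ∎
    where
    vanish : ∀ k → k ≢ punchOut i≢j → f (punchIn i k) ≈ 0#
    vanish k k≢ = f≈0 (punchIn i k) (Finₚ.punchInᵢ≢i i k) λ eq →
      k≢ (Finₚ.punchIn-injective i k _ (≡.trans eq (≡.sym (Finₚ.punchIn-punchOut i≢j))))

  Matrix : ℕ → Set ℓ₁
  Matrix n = Fin n → Fin n → Carrier

  sgn : ℕ → Carrier
  sgn zero    = 1#
  sgn (suc k) = - sgn k

  minor : ∀ {n} → Fin (suc n) → Matrix (suc n) → Matrix n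
  minor j A i k = A (suc i) (punchIn j k)

  det : ∀ n → Matrix n → Carrier
  laplaceTerm : ∀ n → Matrix (suc n) → Fin (suc n) → Carrier

  det zero    A = 1#
  det (suc n) A = sum (laplaceTerm n A)

  laplaceTerm n A j = sgn (toℕ j) * (A zero j * det n (minor j A))

  det-cong : ∀ n {A B : Matrix n} → (∀ i j → A i j ≈ B i j) → det n A ≈ det n B
  det-cong zero    A≈B = ≈-refl
  det-cong (suc n) A≈B = sum-cong-≋ λ j →
    *-congˡ {sgn (toℕ j)} (*-cong (A≈B zero j) (det-cong n λ i k → A≈B (suc i) (punchIn j k)))

  det-linear-column : ∀ n (j : Fin n) {p} (M : Matrix n) (N : Fin p → Matrix n) (c : Fin p → Carrier)
    → (∀ a r k → k ≢ j → N a r k ≈ M r k)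
    → (∀ r → M r j ≈ ∑[ a < p ] (c a * N a r j))
    → det n M ≈ ∑[ a < p ] (c a * det n (N a))

  laplaceTerm-linear : ∀ n (j : Fin (suc n)) {p} (M : Matrix (suc n)) (N : Fin p → Matrix (suc n)) (c : Fin p → Carrier)
    → (∀ a r k → k ≢ j → N a r k ≈ M r k)
    → (∀ r → M r j ≈ ∑[ a < p ] (c a * N a r j))
    → ∀ k → laplaceTerm n M k ≈ ∑[ a < p ] (c a * laplaceTerm n (N a) k)

  det-linear-column (suc n) j {p} M N c N≈M Mⱼ = begin
    sum (laplaceTerm n M)
      ≈⟨ sum-cong-≋ {suc n} (laplaceTerm-linear n j M N c N≈M Mⱼ) ⟩
    ∑[ k < suc n ] ∑[ a < p ] (c a * laplaceTerm n (N a) k)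
      ≈⟨ ∑-comm (λ k a → c a * laplaceTerm n (N a) k) ⟩
    ∑[ a < p ] ∑[ k < suc n ] (c a * laplaceTerm n (N a) k)
      ≈⟨ sum-cong-≋ {p} (λ a → *-distribˡ-sum (c a) (laplaceTerm n (N a))) ⟨
    ∑[ a < p ] (c a * det (suc n) (N a))
      ∎

  laplaceTerm-linear n j {p} M N c N≈M Mⱼ k with k ≟ j
  ... | yes refl = begin
    sgn (toℕ k) * (M zero k * det n (minor k M))
      ≈⟨ *-congˡ (*-congʳ (Mⱼ zero)) ⟩
    sgn (toℕ k) * (∑[ a < p ] (c a * N a zero k) * det n (minor k M))
      ≈⟨ *-congˡ (*-distribʳ-sum {p} _ _) ⟩
    sgn (toℕ k) * ∑[ a < p ] ((c a * N a zero k) * det n (minor k M))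
      ≈⟨ *-distribˡ-sum {p} _ _ ⟩
    ∑[ a < p ] (sgn (toℕ k) * ((c a * N a zero k) * det n (minor k M)))
      ≈⟨ sum-cong-≋ {p} (λ a → trans (*-congˡ (*-assoc _ _ _)) (x∙yz≈y∙xz _ _ _)) ⟩
    ∑[ a < p ] (c a * (sgn (toℕ k) * (N a zero k * det n (minor k M))))
      ≈⟨ sum-cong-≋ {p} (λ a → *-congˡ (*-congˡ (*-congˡ (det-cong n λ r l →
           sym (N≈M a (suc r) (punchIn k l) (Finₚ.punchInᵢ≢i k l)))))) ⟩
    ∑[ a < p ] (c a * laplaceTerm n (N a) k)
      ∎
  ... | no k≢j = begin
    sgn (toℕ k) * (M zero k * det n (minor k M))
      ≈⟨ *-congˡ (*-congˡ minor-linear) ⟩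
    sgn (toℕ k) * (M zero k * ∑[ a < p ] (c a * det n (minor k (N a))))
      ≈⟨ *-congˡ (*-distribˡ-sum {p} _ _) ⟩
    sgn (toℕ k) * ∑[ a < p ] (M zero k * (c a * det n (minor k (N a))))
      ≈⟨ *-distribˡ-sum {p} _ _ ⟩
    ∑[ a < p ] (sgn (toℕ k) * (M zero k * (c a * det n (minor k (N a)))))
      ≈⟨ sum-cong-≋ {p} (λ a → trans (*-congˡ (x∙yz≈y∙xz _ _ _)) (x∙yz≈y∙xz _ _ _)) ⟩
    ∑[ a < p ] (c a * (sgn (toℕ k) * (M zero k * det n (minor k (N a)))))
      ≈⟨ sum-cong-≋ {p} (λ a → *-congˡ (*-congˡ (*-congʳ (sym (N≈M a zero k k≢j))))) ⟩
    ∑[ a < p ] (c a * laplaceTerm n (N a) k)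
      ∎
    where
    punchIn-j′ : punchIn k (punchOut k≢j) ≡ j
    punchIn-j′ = Finₚ.punchIn-punchOut k≢j
    minor-linear : det n (minor k M) ≈ ∑[ a < p ] (c a * det n (minor k (N a)))
    minor-linear = det-linear-column n (punchOut k≢j) (minor k M) (λ a → minor k (N a)) c
      (λ a r l l≢j′ → N≈M a (suc r) (punchIn k l) λ eq →
        l≢j′ (Finₚ.punchIn-injective k l _ (≡.trans eq (≡.sym punchIn-j′))))
      (λ r → ≡.subst (λ x → M (suc r) x ≈ ∑[ a < p ] (c a * N a (suc r) x)) (≡.sym punchIn-j′) (Mⱼ (suc r)))

  det-add-column : ∀ n (j : Fin n) (M N₀ N₁ : Matrix n)
    → (∀ r k → k ≢ j → N₀ r k ≈ M r k) → (∀ r k → k ≢ j → N₁ r k ≈ M r k)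
    → (∀ r → M r j ≈ N₀ r j + N₁ r j)
    → det n M ≈ det n N₀ + det n N₁
  det-add-column n j M N₀ N₁ N₀≈M N₁≈M Mⱼ =
    trans (det-linear-column n j M N (λ _ → 1#) N≈M (λ r → trans (Mⱼ r) (sym (unit-sum _ _))))
          (unit-sum _ _)
    where
    N : Fin 2 → Matrix n
    N zero    = N₀
    N (suc _) = N₁
    N≈M : ∀ a r k → k ≢ j → N a r k ≈ M r k
    N≈M zero       = N₀≈M
    N≈M (suc zero) = N₁≈M
    unit-sum : ∀ x y → 1# * x + (1# * y + 0#) ≈ x + y
    unit-sum x y = +-cong (*-identityˡ x) (trans (+-identityʳ _) (*-identityˡ y))

  det-adjacent-equal-columns : ∀ n (M : Matrix n) (a b : Fin n) → toℕ b ≡ suc (toℕ a)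
    → (∀ r → M r a ≈ M r b) → det n M ≈ 0#
  det-adjacent-equal-columns (suc n) M a b b≡1+a Mₐ≈Mᵦ = begin
    sum (laplaceTerm n M)                    ≈⟨ sum-pair (laplaceTerm n M) a≢b vanish ⟩
    laplaceTerm n M a + laplaceTerm n M b    ≈⟨ +-congˡ term-b ⟩
    laplaceTerm n M a - laplaceTerm n M a    ≈⟨ -‿inverseʳ _ ⟩
    0#                                       ∎
    where
    a≢b : a ≢ b
    a≢b a≡b = ℕₚ.1+n≢n (≡.sym (≡.trans (cong toℕ a≡b) b≡1+a))
    vanish : ∀ k → k ≢ a → k ≢ b → laplaceTerm n M k ≈ 0#
    vanish k k≢a k≢b = trans (*-congˡ (*-congˡ minor-singular)) (trans (*-congˡ (zeroʳ _)) (zeroʳ _))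
      where
      minor-singular : det n (minor k M) ≈ 0#
      minor-singular = det-adjacent-equal-columns n (minor k M) (punchOut k≢a) (punchOut k≢b)
        (punchOut-adjacent k≢a k≢b b≡1+a)
        (λ r → ≡.subst₂ (λ x y → M (suc r) x ≈ M (suc r) y)
          (≡.sym (Finₚ.punchIn-punchOut k≢a)) (≡.sym (Finₚ.punchIn-punchOut k≢b)) (Mₐ≈Mᵦ (suc r)))
    minors-equal : ∀ r k → minor b M r k ≈ minor a M r k
    minors-equal r k with punchIn-adjacent a b b≡1+a k
    ... | inj₁ eq          = ≡.subst (λ x → M (suc r) x ≈ M (suc r) (punchIn a k)) eq ≈-refl
    ... | inj₂ (eq₁ , eq₂) = ≡.subst₂ (λ x y → M (suc r) y ≈ M (suc r) x) (≡.sym eq₁) (≡.sym eq₂) (Mₐ≈Mᵦ (suc r))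
    term-b : laplaceTerm n M b ≈ - laplaceTerm n M a
    term-b = begin
      sgn (toℕ b) * (M zero b * det n (minor b M))
        ≈⟨ *-cong (≡.subst (λ x → sgn x ≈ - sgn (toℕ a)) (≡.sym b≡1+a) ≈-refl)
                  (*-cong (sym (Mₐ≈Mᵦ zero)) (det-cong n minors-equal)) ⟩
      - sgn (toℕ a) * (M zero a * det n (minor a M))
        ≈⟨ -‿distribˡ-* _ _ ⟨
      - laplaceTerm n M a
        ∎

  private
    module TwoColumns {n} (M : Matrix n) {a b : Fin n} (a≢b : a ≢ b) where

      W : (Fin n → Carrier) → (Fin n → Carrier) → Matrix n
      W u v r k with k ≟ a | k ≟ b
      ... | yes _ | _     = u r
      ... | no _  | yes _ = v r
      ... | no _  | no _  = M r k

      W-a : ∀ u v r → W u v r a ≈ u r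
      W-a u v r with a ≟ a
      ... | yes _  = ≈-refl
      ... | no a≢a = ⊥-elim (a≢a refl)

      W-b : ∀ u v r → W u v r b ≈ v r
      W-b u v r with b ≟ a | b ≟ b
      ... | yes b≡a | _      = ⊥-elim (a≢b (≡.sym b≡a))
      ... | no _    | yes _  = ≈-refl
      ... | no _    | no b≢b = ⊥-elim (b≢b refl)

      W-off-a : ∀ u u′ v r k → k ≢ a → W u v r k ≈ W u′ v r k
      W-off-a u u′ v r k k≢a with k ≟ a | k ≟ b
      ... | yes k≡a | _     = ⊥-elim (k≢a k≡a)
      ... | no _    | yes _ = ≈-refl
      ... | no _    | no _  = ≈-refl

      W-off-b : ∀ u v v′ r k → k ≢ b → W u v r k ≈ W u v′ r k
      W-off-b u v v′ r k k≢b with k ≟ a | k ≟ b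
      ... | yes _ | _       = ≈-refl
      ... | no _  | yes k≡b = ⊥-elim (k≢b k≡b)
      ... | no _  | no _    = ≈-refl

      W-matches : ∀ (X : Matrix n) {u v} → (∀ r → X r a ≈ u r) → (∀ r → X r b ≈ v r)
        → (∀ r k → k ≢ a → k ≢ b → X r k ≈ M r k) → ∀ r k → W u v r k ≈ X r k
      W-matches X Xₐ Xᵦ X≈M r k with k ≟ a | k ≟ b
      ... | yes refl | _        = sym (Xₐ r)
      ... | no _     | yes refl = sym (Xᵦ r)
      ... | no k≢a   | no k≢b   = sym (X≈M r k k≢a k≢b)

      _⊕_ : (Fin n → Carrier) → (Fin n → Carrier) → Fin n → Carrier
      (u ⊕ v) r = u r + v r

      det-W-additiveˡ : ∀ u u′ v → det n (W (u ⊕ u′) v) ≈ det n (W u v) + det n (W u′ v)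
      det-W-additiveˡ u u′ v = det-add-column n a _ _ _ (W-off-a u (u ⊕ u′) v) (W-off-a u′ (u ⊕ u′) v)
        λ r → trans (W-a (u ⊕ u′) v r) (sym (+-cong (W-a u v r) (W-a u′ v r)))

      det-W-additiveʳ : ∀ u v v′ → det n (W u (v ⊕ v′)) ≈ det n (W u v) + det n (W u v′)
      det-W-additiveʳ u v v′ = det-add-column n b _ _ _ (W-off-b u v (v ⊕ v′)) (W-off-b u v′ (v ⊕ v′))
        λ r → trans (W-b u (v ⊕ v′) r) (sym (+-cong (W-b u v r) (W-b u v′ r)))

  -- Polarisation: det (W (A ⊕ B) (A ⊕ B)) = 0 splits into four terms, two of which vanish.
  det-transpose-columns-of-alternating : ∀ n {a b : Fin n} → a ≢ b
    → (∀ X → (∀ r → X r a ≈ X r b) → det n X ≈ 0#)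
    → ∀ M → det n (λ r k → M r (transpose a b k)) ≈ - det n M
  det-transpose-columns-of-alternating n {a} {b} a≢b alternating M =
    +-inverseʳ-unique (det n M) (det n M′) (begin
      det n M + det n M′
        ≈⟨ +-cong (det-cong n (W-matches M (λ _ → ≈-refl) (λ _ → ≈-refl) λ _ _ _ _ → ≈-refl))
                  (det-cong n (W-matches M′ (λ r → reflexive (cong (M r) (transpose-ˡ a b)))
                                            (λ r → reflexive (cong (M r) (transpose-ʳ a b)))
                                            λ r k k≢a k≢b → reflexive (cong (M r) (transpose-≢ k≢a k≢b)))) ⟨
      det n (W A B) + det n (W B A)
        ≈⟨ +-cong (+-identityˡ _) (+-identityʳ _) ⟨
      (0# + det n (W A B)) + (det n (W B A) + 0#)
        ≈⟨ +-cong (+-congʳ (W-alternating A)) (+-congˡ (W-alternating B)) ⟨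
      (det n (W A A) + det n (W A B)) + (det n (W B A) + det n (W B B))
        ≈⟨ +-cong (det-W-additiveʳ A A B) (det-W-additiveʳ B A B) ⟨
      det n (W A (A ⊕ B)) + det n (W B (A ⊕ B))
        ≈⟨ det-W-additiveˡ A B (A ⊕ B) ⟨
      det n (W (A ⊕ B) (A ⊕ B))
        ≈⟨ W-alternating (A ⊕ B) ⟩
      0#
        ∎)
    where
    open TwoColumns M a≢b
    M′ : Matrix n
    M′ r k = M r (transpose a b k)
    A B : Fin n → Carrier
    A r = M r a
    B r = M r b
    W-alternating : ∀ u → det n (W u u) ≈ 0#
    W-alternating u = alternating (W u u) λ r → trans (W-a u u r) (sym (W-b u u r))

  private
    det-equal-columns-at-distance : ∀ d n (M : Matrix n) (a b : Fin n) → toℕ b ≡ suc (d ℕ.+ toℕ a)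
      → (∀ r → M r a ≈ M r b) → det n M ≈ 0#
    det-equal-columns-at-distance zero    n       M a b       b≡1+a Mₐ≈Mᵦ = det-adjacent-equal-columns n M a b b≡1+a Mₐ≈Mᵦ
    det-equal-columns-at-distance (suc d) (suc n) M a zero    ()
    det-equal-columns-at-distance (suc d) (suc n) M a (suc b) b≡ Mₐ≈Mᵦ = begin
      det (suc n) M             ≈⟨ -‿involutive _ ⟨
      - - det (suc n) M         ≈⟨ -‿cong (det-transpose-columns-of-alternating (suc n) c≢b′ adjacent M) ⟨
      - det (suc n) M′          ≈⟨ -‿cong M′-singular ⟩
      - 0#                      ≈⟨ -0#≈0# ⟩
      0#                        ∎
      where
      c b′ : Fin (suc n)
      c  = Fin.inject₁ b
      b′ = suc b
      c≡ : toℕ c ≡ suc (d ℕ.+ toℕ a)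
      c≡ = ≡.trans (Finₚ.toℕ-inject₁ b) (ℕₚ.suc-injective b≡)
      b′≡1+c : toℕ b′ ≡ suc (toℕ c)
      b′≡1+c = cong suc (≡.sym (Finₚ.toℕ-inject₁ b))
      c≢b′ : c ≢ b′
      c≢b′ c≡b′ = ℕₚ.1+n≢n (≡.sym (≡.trans (cong toℕ c≡b′) b′≡1+c))
      a≢c : a ≢ c
      a≢c a≡c = ℕₚ.m≢1+n+m (toℕ a) (≡.trans (cong toℕ a≡c) c≡)
      a≢b′ : a ≢ b′
      a≢b′ a≡b′ = ℕₚ.m≢1+n+m (toℕ a) (≡.trans (cong toℕ a≡b′) (≡.trans b′≡1+c (cong suc c≡)))
      adjacent : ∀ X → (∀ r → X r c ≈ X r b′) → det (suc n) X ≈ 0#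
      adjacent X = det-adjacent-equal-columns (suc n) X c b′ b′≡1+c
      M′ : Matrix (suc n)
      M′ r k = M r (transpose c b′ k)
      M′-singular : det (suc n) M′ ≈ 0#
      M′-singular = det-equal-columns-at-distance d (suc n) M′ a c c≡ λ r →
        ≡.subst₂ (λ x y → M r x ≈ M r y) (≡.sym (transpose-≢ a≢c a≢b′)) (≡.sym (transpose-ˡ c b′)) (Mₐ≈Mᵦ r)

    distance : ∀ {m n} → m ℕ.< n → n ≡ suc ((n ℕ.∸ suc m) ℕ.+ m)
    distance {m} m<n = ≡.trans (≡.sym (ℕₚ.m∸n+n≡m m<n)) (ℕₚ.+-suc _ m)

  det-equal-columns : ∀ n (M : Matrix n) {a b : Fin n} → a ≢ b → (∀ r → M r a ≈ M r b) → det n M ≈ 0#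
  det-equal-columns n M {a} {b} a≢b Mₐ≈Mᵦ with ℕₚ.<-cmp (toℕ a) (toℕ b)
  ... | tri< a<b _ _ = det-equal-columns-at-distance _ n M a b (distance a<b) Mₐ≈Mᵦ
  ... | tri≈ _ a≡b _ = ⊥-elim (a≢b (Finₚ.toℕ-injective a≡b))
  ... | tri> _ _ b<a = det-equal-columns-at-distance _ n M b a (distance b<a) (sym ∘ Mₐ≈Mᵦ)

  det-transpose-columns : ∀ n {a b : Fin n} → a ≢ b → ∀ M → det n (λ r k → M r (transpose a b k)) ≈ - det n M
  det-transpose-columns n a≢b = det-transpose-columns-of-alternating n a≢b λ X → det-equal-columns n X a≢b

  I : ∀ {n} → Matrix n
  I i j with i ≟ j
  ... | yes _ = 1#
  ... | no _  = 0#

  I-diag : ∀ {n} (i : Fin n) → I i i ≈ 1#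
  I-diag i with i ≟ i
  ... | yes _  = ≈-refl
  ... | no i≢i = ⊥-elim (i≢i refl)

  I-offDiag : ∀ {n} {i j : Fin n} → i ≢ j → I i j ≈ 0#
  I-offDiag {i = i} {j} i≢j with i ≟ j
  ... | yes i≡j = ⊥-elim (i≢j i≡j)
  ... | no _    = ≈-refl

  I-suc : ∀ {n} (i j : Fin n) → I (suc i) (suc j) ≈ I i j
  I-suc i j with i ≟ j
  ... | yes refl = ≈-refl
  ... | no _     = ≈-refl

  I-injective : ∀ {m n} (σ : Fin m → Fin n) → Injective _≡_ _≡_ σ → ∀ i j → I (σ i) (σ j) ≈ I i j
  I-injective σ σ-inj i j with i ≟ j
  ... | yes refl = I-diag (σ i)
  ... | no i≢j   = I-offDiag (i≢j ∘ σ-inj)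

  sum-I-* : ∀ n (g : Fin n → Carrier) i → ∑[ k < n ] (I i k * g k) ≈ g i
  sum-I-* n g i = trans (sum-single {n} _ i λ k k≢i → trans (*-congʳ (I-offDiag (k≢i ∘ ≡.sym))) (zeroˡ _))
                        (trans (*-congʳ (I-diag i)) (*-identityˡ _))

  sum-*-I : ∀ n (g : Fin n → Carrier) j → ∑[ k < n ] (g k * I k j) ≈ g j
  sum-*-I n g j = trans (sum-single {n} _ j λ k k≢j → trans (*-congˡ (I-offDiag k≢j)) (zeroʳ _))
                        (trans (*-congˡ (I-diag j)) (*-identityʳ _))

  sum-reindex : ∀ m n (ψ : Fin m → Fin n) (φ : Fin n → Fin m) (f : Fin n → Carrier)
    → Injective _≡_ _≡_ ψ → (∀ e → ψ (φ e) ≢ e → f e ≈ 0#)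
    → ∑[ a < m ] f (ψ a) ≈ sum f
  sum-reindex m n ψ φ f ψ-inj f≈0 = begin
    ∑[ a < m ] f (ψ a)                        ≈⟨ sum-cong-≋ {m} (λ a → sum-I-* n f (ψ a)) ⟨
    ∑[ a < m ] ∑[ e < n ] (I (ψ a) e * f e)   ≈⟨ ∑-comm (λ a e → I (ψ a) e * f e) ⟩
    ∑[ e < n ] ∑[ a < m ] (I (ψ a) e * f e)   ≈⟨ sum-cong-≋ {n} collapse ⟩
    sum f                                     ∎
    where
    collapse : ∀ e → ∑[ a < m ] (I (ψ a) e * f e) ≈ f e
    collapse e with ψ (φ e) ≟ e
    ... | yes ψφe≡e = trans (sum-single {m} _ (φ e) λ a a≢φe →
                             trans (*-congʳ (I-offDiag λ ψa≡e → a≢φe (ψ-inj (≡.trans ψa≡e (≡.sym ψφe≡e))))) (zeroˡ _))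
                            (trans (*-congʳ (trans (reflexive (cong (λ x → I x e) ψφe≡e)) (I-diag e))) (*-identityˡ _))
    ... | no ψφe≢e  = trans (sum-zero m λ a → trans (*-congˡ (f≈0 e ψφe≢e)) (zeroʳ _)) (sym (f≈0 e ψφe≢e))

  det-I : ∀ n → det n I ≈ 1#
  det-I zero    = ≈-refl
  det-I (suc n) = begin
    sum (laplaceTerm n I)                   ≈⟨ sum-single _ zero off-zero ⟩
    laplaceTerm n I zero                    ≈⟨ *-identityˡ _ ⟩
    I {suc n} zero zero * det n (minor zero I) ≈⟨ *-cong (I-diag {suc n} zero) (trans (det-cong n (I-suc {n})) (det-I n)) ⟩
    1# * 1#                                 ≈⟨ *-identityˡ 1# ⟩
    1#                                      ∎
    where
    off-zero : ∀ k → k ≢ zero → laplaceTerm n I k ≈ 0#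
    off-zero k k≢0 = trans (*-congˡ (trans (*-congʳ (I-offDiag (k≢0 ∘ ≡.sym))) (zeroˡ _))) (zeroʳ _)

  selectColumns : ∀ {n} → Matrix n → (Fin n → Fin n) → Matrix n
  selectColumns A f r k = A r (f k)

  private
    SelectFormula : ∀ n → Matrix n → (Fin n → Fin n) → Set ℓ₂
    SelectFormula n A f = det n (selectColumns A f) ≈ det n A * det n (selectColumns I f)

    select-formula-collision : ∀ n (A : Matrix n) (f : Fin n → Fin n) {i i′} → i ≢ i′ → f i ≡ f i′
      → SelectFormula n A f
    select-formula-collision n A f i≢i′ fi≡fi′ = begin
      det n (selectColumns A f)           ≈⟨ det-equal-columns n _ i≢i′ (λ r → reflexive (cong (A r) fi≡fi′)) ⟩
      0#                                  ≈⟨ zeroʳ _ ⟨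
      det n A * 0#                        ≈⟨ *-congˡ (det-equal-columns n _ i≢i′ (λ r → reflexive (cong (I r) fi≡fi′))) ⟨
      det n A * det n (selectColumns I f) ∎

    select-formula-transpose : ∀ n (A : Matrix n) (f : Fin n → Fin n) {i j} → i ≢ j
      → SelectFormula n A (f ∘ transpose i j) → SelectFormula n A f
    select-formula-transpose n A f {i} {j} i≢j formula = begin
      det n (selectColumns A f)               ≈⟨ swap A ⟩
      - det n (selectColumns A g)             ≈⟨ -‿cong formula ⟩
      - (det n A * det n (selectColumns I g)) ≈⟨ -‿distribʳ-* _ _ ⟩
      det n A * - det n (selectColumns I g)   ≈⟨ *-congˡ (swap I) ⟨
      det n A * det n (selectColumns I f)     ∎
      where
      g : Fin n → Fin n
      g = f ∘ transpose i j
      swap : ∀ X → det n (selectColumns X f) ≈ - det n (selectColumns X g)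
      swap X = trans (det-cong n λ r k → reflexive (cong (X r ∘ f) (≡.sym (transpose-inverse i j))))
                     (det-transpose-columns n (i≢j ∘ ≡.sym) (selectColumns X g))

    fixed-from : ∀ {n} (f : Fin n → Fin n) {m} (m<n : m ℕ.< n) → f (Fin.fromℕ< m<n) ≡ Fin.fromℕ< m<n
      → (∀ k → suc m ℕ.≤ toℕ k → f k ≡ k) → ∀ k → m ℕ.≤ toℕ k → f k ≡ k
    fixed-from f m<n fc₀≡c₀ fixes k m≤k with ℕₚ.m≤n⇒m<n∨m≡n m≤k
    ... | inj₁ m<k = fixes k m<k
    ... | inj₂ m≡k = ≡.subst (λ x → f x ≡ x) (Finₚ.toℕ-injective (≡.trans (Finₚ.toℕ-fromℕ< m<n) m≡k)) fc₀≡c₀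

    -- Induction on m, where f fixes every column from m on: column m is fixed, or missed by f
    -- (and then f is not injective), or hit by some j, and composing f with (j m) fixes it.
    select-formula-fixing : ∀ n (A : Matrix n) m (f : Fin n → Fin n) → (∀ k → m ℕ.≤ toℕ k → f k ≡ k)
      → SelectFormula n A f
    select-formula-fixing n A zero f fixes = begin
      det n (selectColumns A f)           ≈⟨ det-cong n (λ r k → reflexive (cong (A r) (fixes k ℕ.z≤n))) ⟩
      det n A                             ≈⟨ *-identityʳ _ ⟨
      det n A * 1#                        ≈⟨ *-congˡ (trans (det-cong n λ r k → reflexive (cong (I r) (fixes k ℕ.z≤n))) (det-I n)) ⟨
      det n A * det n (selectColumns I f) ∎
    select-formula-fixing n A (suc m) f fixes with m ℕ.<? n
    ... | no m≮n = select-formula-fixing n A m f λ k m≤k → ⊥-elim (m≮n (ℕₚ.≤-<-trans m≤k (Finₚ.toℕ<n k)))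
    ... | yes m<n with f c₀ ≟ c₀ | Finₚ.any? (λ j → f j ≟ c₀)
      where c₀ = Fin.fromℕ< m<n
    ...   | yes fc₀≡c₀ | _ = select-formula-fixing n A m f (fixed-from f m<n fc₀≡c₀ fixes)
    ...   | no _ | no ∄j with missing⇒collision f _ (λ j fj≡c₀ → ∄j (j , fj≡c₀))
    ...     | i , i′ , i≢i′ , fi≡fi′ = select-formula-collision n A f i≢i′ fi≡fi′
    select-formula-fixing n A (suc m) f fixes | yes m<n | no fc₀≢c₀ | yes (j , fj≡c₀) =
      select-formula-transpose n A f j≢c₀ (select-formula-fixing n A m (f ∘ transpose j c₀) g-fixes)
      where
      c₀ : Fin n
      c₀ = Fin.fromℕ< m<n
      j≢c₀ : j ≢ c₀
      j≢c₀ j≡c₀ = fc₀≢c₀ (≡.subst (λ x → f x ≡ c₀) j≡c₀ fj≡c₀)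
      g-fixes : ∀ k → m ℕ.≤ toℕ k → f (transpose j c₀ k) ≡ k
      g-fixes = fixed-from (f ∘ transpose j c₀) m<n (≡.trans (cong f (transpose-ʳ j c₀)) fj≡c₀) λ k m<k →
        let k≢c₀ : k ≢ c₀
            k≢c₀ k≡c₀ = ℕₚ.<-irrefl (≡.trans (≡.sym (Finₚ.toℕ-fromℕ< m<n)) (cong toℕ (≡.sym k≡c₀))) m<k
            k≢j : k ≢ j
            k≢j k≡j = j≢c₀ (≡.trans (≡.sym (fixes j (≡.subst (λ x → suc m ℕ.≤ toℕ x) k≡j m<k))) fj≡c₀)
        in ≡.trans (cong f (transpose-≢ k≢j k≢c₀)) (fixes k m<k)

  det-select-columns : ∀ n (A : Matrix n) (f : Fin n → Fin n)
    → det n (selectColumns A f) ≈ det n A * det n (selectColumns I f)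
  det-select-columns n A f = select-formula-fixing n A n f λ k n≤k → ⊥-elim (ℕₚ.<⇒≱ (Finₚ.toℕ<n k) n≤k)

  I-sym : ∀ {n} (i j : Fin n) → I i j ≈ I j i
  I-sym i j with i ≟ j | j ≟ i
  ... | yes _   | yes _   = ≈-refl
  ... | no _    | no _    = ≈-refl
  ... | yes i≡j | no j≢i  = ⊥-elim (j≢i (≡.sym i≡j))
  ... | no i≢j  | yes j≡i = ⊥-elim (i≢j (≡.sym j≡i))

  basis : ∀ {n} → Fin n → Fin n → Carrier
  basis a r = I r a

  sumFunctions : ∀ m {n} → ((Fin m → Fin n) → Carrier) → Carrier
  sumFunctions zero        Φ = Φ (λ ())
  sumFunctions (suc m) {n} Φ = ∑[ a < n ] sumFunctions m (λ g → Φ (a Vector.∷ g))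

  sumFunctions-cong : ∀ m {n} {Φ Ψ : (Fin m → Fin n) → Carrier} → (∀ f → Φ f ≈ Ψ f)
    → sumFunctions m Φ ≈ sumFunctions m Ψ
  sumFunctions-cong zero        Φ≈Ψ = Φ≈Ψ _
  sumFunctions-cong (suc m) {n} Φ≈Ψ = sum-cong-≋ {n} λ a → sumFunctions-cong m λ g → Φ≈Ψ (a Vector.∷ g)

  *-distribˡ-sumFunctions : ∀ m {n} x (Φ : (Fin m → Fin n) → Carrier)
    → x * sumFunctions m Φ ≈ sumFunctions m (λ f → x * Φ f)
  *-distribˡ-sumFunctions zero        x Φ = ≈-refl
  *-distribˡ-sumFunctions (suc m) {n} x Φ = trans (*-distribˡ-sum {n} x _)
    (sum-cong-≋ {n} λ a → *-distribˡ-sumFunctions m x (λ g → Φ (a Vector.∷ g)))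

  multilinear-expansion : ∀ m {n} (D : (Fin m → Fin n → Carrier) → Carrier)
    → (∀ {X Y} → (∀ j r → X j r ≈ Y j r) → D X ≈ D Y)
    → (∀ X j → D X ≈ ∑[ a < n ] (X j a * D (updateAt X j (const (basis a)))))
    → ∀ X → D X ≈ sumFunctions m (λ f → product (λ j → X j (f j)) * D (basis ∘ f))
  multilinear-expansion zero        D D-cong D-linear X = trans (D-cong λ ()) (sym (*-identityˡ _))
  multilinear-expansion (suc m) {n} D D-cong D-linear X = begin
    D X
      ≈⟨ D-linear X zero ⟩
    ∑[ a < n ] (X zero a * D (updateAt X zero (const (basis a))))
      ≈⟨ sum-cong-≋ {n} (λ a → *-congˡ (trans (D-cong λ { zero r → ≈-refl ; (suc j) r → ≈-refl })
           (multilinear-expansion m (Dₐ a) (Dₐ-cong a) (Dₐ-linear a) (Vector.tail X)))) ⟩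
    ∑[ a < n ] (X zero a * sumFunctions m (λ g → product (λ j → X (suc j) (g j)) * Dₐ a (basis ∘ g)))
      ≈⟨ sum-cong-≋ {n} (λ a → trans (*-distribˡ-sumFunctions m _ _) (sumFunctions-cong m λ g →
           trans (sym (*-assoc _ _ _)) (*-congˡ (D-cong λ { zero r → ≈-refl ; (suc j) r → ≈-refl })))) ⟩
    sumFunctions (suc m) (λ f → product (λ j → X j (f j)) * D (basis ∘ f))
      ∎
    where
    Dₐ : Fin n → (Fin m → Fin n → Carrier) → Carrier
    Dₐ a Y = D (basis a Vector.∷ Y)
    Dₐ-cong : ∀ a {Y Z} → (∀ j r → Y j r ≈ Z j r) → Dₐ a Y ≈ Dₐ a Z
    Dₐ-cong a Y≈Z = D-cong λ { zero r → ≈-refl ; (suc j) r → Y≈Z j r }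
    Dₐ-linear : ∀ a Y j → Dₐ a Y ≈ ∑[ b < n ] (Y j b * Dₐ a (updateAt Y j (const (basis b))))
    Dₐ-linear a Y j = trans (D-linear (basis a Vector.∷ Y) (suc j))
      (sum-cong-≋ {n} λ b → *-congˡ (D-cong λ { zero r → ≈-refl ; (suc k) r → ≈-refl }))

  infixl 7 _*M_
  _*M_ : ∀ {n} → Matrix n → Matrix n → Matrix n
  _*M_ {n} A B r c = ∑[ k < n ] (A r k * B k c)

  fromColumns : ∀ {n} → (Fin n → Fin n → Carrier) → Matrix n
  fromColumns X r c = X c r

  det-fromColumns-linear : ∀ n X (j : Fin n)
    → det n (fromColumns X) ≈ ∑[ a < n ] (X j a * det n (fromColumns (updateAt X j (const (basis a)))))
  det-fromColumns-linear n X j = det-linear-column n j _ _ (λ a → X j a)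
    (λ a r k k≢j → reflexive (cong (λ Y → Y r) (updateAt-minimal k j X k≢j)))
    (λ r → sym (begin
      ∑[ a < n ] (X j a * updateAt X j (const (basis a)) j r)
        ≈⟨ sum-cong-≋ {n} (λ a → *-congˡ (reflexive (cong (λ v → v r) (updateAt-updates j X)))) ⟩
      ∑[ a < n ] (X j a * I r a)
        ≈⟨ sum-cong-≋ {n} (λ a → *-congˡ (I-sym r a)) ⟩
      ∑[ a < n ] (X j a * I a r)
        ≈⟨ sum-*-I n (X j) r ⟩
      X j r ∎))

  det-*M-fromColumns-linear : ∀ n (A : Matrix n) X (j : Fin n)
    → det n (A *M fromColumns X) ≈ ∑[ a < n ] (X j a * det n (A *M fromColumns (updateAt X j (const (basis a)))))
  det-*M-fromColumns-linear n A X j = det-linear-column n j _ _ (λ a → X j a)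
    (λ a r k k≢j → sum-cong-≋ {n} λ l → *-congˡ (reflexive (cong (λ Y → Y l) (updateAt-minimal k j X k≢j))))
    (λ r → sym (begin
      ∑[ a < n ] (X j a * ∑[ l < n ] (A r l * updateAt X j (const (basis a)) j l))
        ≈⟨ sum-cong-≋ {n} (λ a → *-congˡ (sum-cong-≋ {n} λ l → *-congˡ (reflexive (cong (λ v → v l) (updateAt-updates j X))))) ⟩
      ∑[ a < n ] (X j a * ∑[ l < n ] (A r l * I l a))
        ≈⟨ sum-cong-≋ {n} (λ a → trans (*-congˡ (sum-*-I n (A r) a)) (*-comm _ _)) ⟩
      ∑[ a < n ] (A r a * X j a)
        ∎))

  det-*M : ∀ n (A B : Matrix n) → det n (A *M B) ≈ det n A * det n B
  det-*M n A B = begin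
    det n (A *M fromColumns columns)
      ≈⟨ multilinear-expansion n _ (λ X≈Y → det-cong n λ r c → sum-cong-≋ {n} λ k → *-congˡ (X≈Y c k))
                                   (det-*M-fromColumns-linear n A) columns ⟩
    sumFunctions n (λ f → product (λ j → columns j (f j)) * det n (A *M selectColumns I f))
      ≈⟨ sumFunctions-cong n (λ f → *-congˡ (trans (det-cong n λ r c → sum-*-I n (A r) (f c)) (det-select-columns n A f))) ⟩
    sumFunctions n (λ f → product (λ j → columns j (f j)) * (det n A * det n (selectColumns I f)))
      ≈⟨ sumFunctions-cong n (λ f → x∙yz≈y∙xz _ _ _) ⟩
    sumFunctions n (λ f → det n A * (product (λ j → columns j (f j)) * det n (selectColumns I f)))
      ≈⟨ *-distribˡ-sumFunctions n _ _ ⟨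
    det n A * sumFunctions n (λ f → product (λ j → columns j (f j)) * det n (selectColumns I f))
      ≈⟨ *-congˡ (multilinear-expansion n _ (λ X≈Y → det-cong n λ r c → X≈Y c r) (det-fromColumns-linear n) columns) ⟨
    det n A * det n B
      ∎
    where
    columns : Fin n → Fin n → Carrier
    columns c r = B r c

  det-reindex : ∀ {m n} → m ≡ n → (A : Matrix n) (σ : Fin m → Fin n) → Injective _≡_ _≡_ σ
    → det m (λ r c → A (σ r) (σ c)) ≈ det n A
  det-reindex {n = n} refl A σ σ-inj = begin
    det n (λ r c → A (σ r) (σ c))     ≈⟨ det-cong n (λ r c → trans (sum-I-* n _ (σ r)) (sum-*-I n (A (σ r)) (σ c))) ⟨
    det n (P *M (A *M Q))             ≈⟨ det-*M n P (A *M Q) ⟩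
    det n P * det n (A *M Q)          ≈⟨ *-congˡ (det-*M n A Q) ⟩
    det n P * (det n A * det n Q)     ≈⟨ x∙yz≈y∙xz _ _ _ ⟩
    det n A * (det n P * det n Q)     ≈⟨ *-congˡ (det-*M n P Q) ⟨
    det n A * det n (P *M Q)          ≈⟨ *-congˡ (trans (det-cong n λ r c → trans (sum-I-* n _ (σ r)) (I-injective σ σ-inj r c))
                                                        (det-I n)) ⟩
    det n A * 1#                      ≈⟨ *-identityʳ _ ⟩
    det n A                           ∎
    where
    P Q : Matrix n
    P r k = I (σ r) k
    Q k c = I k (σ c)

  det-negate : ∀ n (A : Matrix n) → det n (λ r c → - A r c) ≈ sgn n * det n A
  det-negate zero    A = sym (*-identityˡ _)
  det-negate (suc n) A = begin
    ∑[ j < suc n ] (sgn (toℕ j) * (- A zero j * det n (λ r c → - minor j A r c)))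
      ≈⟨ sum-cong-≋ {suc n} (λ j → *-congˡ {sgn (toℕ j)} (*-congˡ { - A zero j} (det-negate n (minor j A)))) ⟩
    ∑[ j < suc n ] (sgn (toℕ j) * (- A zero j * (sgn n * det n (minor j A))))
      ≈⟨ sum-cong-≋ {suc n} (λ j → pull-sign (sgn (toℕ j)) (A zero j) (sgn n) (det n (minor j A))) ⟩
    ∑[ j < suc n ] (- sgn n * laplaceTerm n A j)
      ≈⟨ *-distribˡ-sum (- sgn n) (laplaceTerm n A) ⟨
    - sgn n * det (suc n) A
      ∎
    where
    pull-sign : ∀ s a t d → s * (- a * (t * d)) ≈ - t * (s * (a * d))
    pull-sign s a t d = begin
      s * (- a * (t * d))     ≈⟨ *-congˡ (-‿distribˡ-* a (t * d)) ⟨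
      s * - (a * (t * d))     ≈⟨ -‿distribʳ-* s _ ⟨
      - (s * (a * (t * d)))   ≈⟨ -‿cong (trans (*-congˡ (x∙yz≈y∙xz a t d)) (x∙yz≈y∙xz s t _)) ⟩
      - (t * (s * (a * d)))   ≈⟨ -‿distribˡ-* t _ ⟩
      - t * (s * (a * d))     ∎

  sum-split : ∀ m n (f : Fin (m ℕ.+ n) → Carrier) → sum f ≈ ∑[ i < m ] f (i ↑ˡ n) + ∑[ i < n ] f (m ↑ʳ i)
  sum-split zero    n f = sym (+-identityˡ _)
  sum-split (suc m) n f = trans (+-congˡ (sum-split m n (f ∘ suc))) (sym (+-assoc _ _ _))

  det-blockTriangular : ∀ h k (M : Matrix (h ℕ.+ k)) → (∀ i j → M (i ↑ˡ k) (h ↑ʳ j) ≈ 0#)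
    → det (h ℕ.+ k) M ≈ det h (λ i j → M (i ↑ˡ k) (j ↑ˡ k)) * det k (λ i j → M (h ↑ʳ i) (h ↑ʳ j))
  det-blockTriangular zero    k M _     = sym (*-identityˡ _)
  det-blockTriangular (suc h) k M upper = begin
    sum (laplaceTerm (h ℕ.+ k) M)
      ≈⟨ sum-split (suc h) k (laplaceTerm (h ℕ.+ k) M) ⟩
    ∑[ j < suc h ] laplaceTerm (h ℕ.+ k) M (j ↑ˡ k) + ∑[ j < k ] laplaceTerm (h ℕ.+ k) M (suc h ↑ʳ j)
      ≈⟨ +-congˡ (sum-zero k λ j → trans (*-congˡ (trans (*-congʳ (upper zero j)) (zeroˡ _))) (zeroʳ _)) ⟩
    ∑[ j < suc h ] laplaceTerm (h ℕ.+ k) M (j ↑ˡ k) + 0#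
      ≈⟨ +-identityʳ _ ⟩
    ∑[ j < suc h ] laplaceTerm (h ℕ.+ k) M (j ↑ˡ k)
      ≈⟨ sum-cong-≋ {suc h} left-term ⟩
    ∑[ j < suc h ] (laplaceTerm h TL j * det k BR)
      ≈⟨ *-distribʳ-sum (det k BR) (laplaceTerm h TL) ⟨
    det (suc h) TL * det k BR
      ∎
    where
    TL : Matrix (suc h)
    TL i j = M (i ↑ˡ k) (j ↑ˡ k)
    BR : Matrix k
    BR i j = M (suc h ↑ʳ i) (suc h ↑ʳ j)
    left-term : ∀ j → laplaceTerm (h ℕ.+ k) M (j ↑ˡ k) ≈ laplaceTerm h TL j * det k BR
    left-term j = begin
      sgn (toℕ (j ↑ˡ k)) * (M zero (j ↑ˡ k) * det (h ℕ.+ k) (minor (j ↑ˡ k) M))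
        ≈⟨ *-cong (reflexive (cong sgn (Finₚ.toℕ-↑ˡ j k))) (*-congˡ (det-blockTriangular h k _ λ i l →
             ≡.subst (λ x → M (suc (i ↑ˡ k)) x ≈ 0#) (≡.sym (punchIn-↑ʳ k j l)) (upper (suc i) l))) ⟩
      sgn (toℕ j) * (TL zero j * (det h (λ i l → M (suc (i ↑ˡ k)) (punchIn (j ↑ˡ k) (l ↑ˡ k)))
                                  * det k (λ i l → M (suc (h ↑ʳ i)) (punchIn (j ↑ˡ k) (h ↑ʳ l)))))
        ≈⟨ *-congˡ (*-congˡ (*-cong
             (det-cong h λ i l → reflexive (cong (M (suc (i ↑ˡ k))) (punchIn-↑ˡ k j l)))
             (det-cong k λ i l → reflexive (cong (M (suc h ↑ʳ i)) (punchIn-↑ʳ k j l))))) ⟩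
      sgn (toℕ j) * (TL zero j * (det h (minor j TL) * det k BR))
        ≈⟨ trans (*-assoc _ _ _) (*-congˡ (*-assoc _ _ _)) ⟨
      laplaceTerm h TL j * det k BR
        ∎

  module Blocks (h : ℕ) where

    ⇑ˡ ⇑ʳ : Fin h → Fin (h ℕ.+ h)
    ⇑ˡ i = i ↑ˡ h
    ⇑ʳ i = h ↑ʳ i

    scalarBlocks : Carrier → Carrier → Carrier → Carrier → Matrix (h ℕ.+ h)
    scalarBlocks a b c d r s = [ (λ i → row a b i (splitAt h s)) , (λ i → row c d i (splitAt h s)) ]′ (splitAt h r)
      where
      row : Carrier → Carrier → Fin h → Fin h ⊎ Fin h → Carrier
      row x y i (inj₁ j) = x * I i j
      row x y i (inj₂ j) = y * I i j

    module _ (a b c d : Carrier) (i j : Fin h) where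
      scalarBlocks-ˡˡ : scalarBlocks a b c d (⇑ˡ i) (⇑ˡ j) ≡ a * I i j
      scalarBlocks-ˡˡ rewrite Finₚ.splitAt-↑ˡ h i h | Finₚ.splitAt-↑ˡ h j h = refl
      scalarBlocks-ˡʳ : scalarBlocks a b c d (⇑ˡ i) (⇑ʳ j) ≡ b * I i j
      scalarBlocks-ˡʳ rewrite Finₚ.splitAt-↑ˡ h i h | Finₚ.splitAt-↑ʳ h h j = refl
      scalarBlocks-ʳˡ : scalarBlocks a b c d (⇑ʳ i) (⇑ˡ j) ≡ c * I i j
      scalarBlocks-ʳˡ rewrite Finₚ.splitAt-↑ʳ h h i | Finₚ.splitAt-↑ˡ h j h = refl
      scalarBlocks-ʳʳ : scalarBlocks a b c d (⇑ʳ i) (⇑ʳ j) ≡ d * I i j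
      scalarBlocks-ʳʳ rewrite Finₚ.splitAt-↑ʳ h h i | Finₚ.splitAt-↑ʳ h h j = refl

    private
      sum-*-scaledI : ∀ (g : Fin h → Carrier) x j → ∑[ k < h ] (g k * (x * I k j)) ≈ g j * x
      sum-*-scaledI g x j = trans (sum-cong-≋ {h} λ k → sym (*-assoc (g k) x (I k j)))
                                  (sum-*-I h (λ k → g k * x) j)

      sum-scaledI-* : ∀ (g : Fin h → Carrier) x i → ∑[ k < h ] ((x * I i k) * g k) ≈ x * g i
      sum-scaledI-* g x i = begin
        ∑[ k < h ] ((x * I i k) * g k)   ≈⟨ sum-cong-≋ {h} (λ k → *-assoc x (I i k) (g k)) ⟩
        ∑[ k < h ] (x * (I i k * g k))   ≈⟨ *-distribˡ-sum x (λ k → I i k * g k) ⟨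
        x * ∑[ k < h ] (I i k * g k)     ≈⟨ *-congˡ (sum-I-* h g i) ⟩
        x * g i                          ∎

    module _ (a b c d : Carrier) where
      private
        B : Matrix (h ℕ.+ h)
        B = scalarBlocks a b c d

      *M-scalarBlocks-ˡ : ∀ (M : Matrix (h ℕ.+ h)) r j → (M *M B) r (⇑ˡ j) ≈ M r (⇑ˡ j) * a + M r (⇑ʳ j) * c
      *M-scalarBlocks-ˡ M r j = trans (sum-split h h _) (+-cong
        (trans (sum-cong-≋ {h} λ k → *-congˡ (reflexive (scalarBlocks-ˡˡ a b c d k j))) (sum-*-scaledI (M r ∘ ⇑ˡ) a j))
        (trans (sum-cong-≋ {h} λ k → *-congˡ (reflexive (scalarBlocks-ʳˡ a b c d k j))) (sum-*-scaledI (M r ∘ ⇑ʳ) c j)))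

      *M-scalarBlocks-ʳ : ∀ (M : Matrix (h ℕ.+ h)) r j → (M *M B) r (⇑ʳ j) ≈ M r (⇑ˡ j) * b + M r (⇑ʳ j) * d
      *M-scalarBlocks-ʳ M r j = trans (sum-split h h _) (+-cong
        (trans (sum-cong-≋ {h} λ k → *-congˡ (reflexive (scalarBlocks-ˡʳ a b c d k j))) (sum-*-scaledI (M r ∘ ⇑ˡ) b j))
        (trans (sum-cong-≋ {h} λ k → *-congˡ (reflexive (scalarBlocks-ʳʳ a b c d k j))) (sum-*-scaledI (M r ∘ ⇑ʳ) d j)))

      scalarBlocks-*M-ˡ : ∀ (M : Matrix (h ℕ.+ h)) i s → (B *M M) (⇑ˡ i) s ≈ a * M (⇑ˡ i) s + b * M (⇑ʳ i) s
      scalarBlocks-*M-ˡ M i s = trans (sum-split h h _) (+-cong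
        (trans (sum-cong-≋ {h} λ k → *-congʳ (reflexive (scalarBlocks-ˡˡ a b c d i k))) (sum-scaledI-* (λ k → M (⇑ˡ k) s) a i))
        (trans (sum-cong-≋ {h} λ k → *-congʳ (reflexive (scalarBlocks-ˡʳ a b c d i k))) (sum-scaledI-* (λ k → M (⇑ʳ k) s) b i)))

      scalarBlocks-*M-ʳ : ∀ (M : Matrix (h ℕ.+ h)) i s → (B *M M) (⇑ʳ i) s ≈ c * M (⇑ˡ i) s + d * M (⇑ʳ i) s
      scalarBlocks-*M-ʳ M i s = trans (sum-split h h _) (+-cong
        (trans (sum-cong-≋ {h} λ k → *-congʳ (reflexive (scalarBlocks-ʳˡ a b c d i k))) (sum-scaledI-* (λ k → M (⇑ˡ k) s) c i))
        (trans (sum-cong-≋ {h} λ k → *-congʳ (reflexive (scalarBlocks-ʳʳ a b c d i k))) (sum-scaledI-* (λ k → M (⇑ʳ k) s) d i)))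

    det-scalarBlocks-unitriangular : ∀ c → det (h ℕ.+ h) (scalarBlocks 1# 0# c 1#) ≈ 1#
    det-scalarBlocks-unitriangular c = begin
      det (h ℕ.+ h) (scalarBlocks 1# 0# c 1#)
        ≈⟨ det-blockTriangular h h _ (λ i j → trans (reflexive (scalarBlocks-ˡʳ 1# 0# c 1# i j)) (zeroˡ _)) ⟩
      det h (λ i j → scalarBlocks 1# 0# c 1# (⇑ˡ i) (⇑ˡ j)) * det h (λ i j → scalarBlocks 1# 0# c 1# (⇑ʳ i) (⇑ʳ j))
        ≈⟨ *-cong (trans (det-cong h λ i j → trans (reflexive (scalarBlocks-ˡˡ 1# 0# c 1# i j)) (*-identityˡ _)) (det-I h))
                  (trans (det-cong h λ i j → trans (reflexive (scalarBlocks-ʳʳ 1# 0# c 1# i j)) (*-identityˡ _)) (det-I h)) ⟩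
      1# * 1#
        ≈⟨ *-identityˡ 1# ⟩
      1#
        ∎

    swapHalves : Fin (h ℕ.+ h) → Fin (h ℕ.+ h)
    swapHalves r = [ ⇑ʳ , ⇑ˡ ]′ (splitAt h r)

    swapHalves-ˡ : ∀ i → swapHalves (⇑ˡ i) ≡ ⇑ʳ i
    swapHalves-ˡ i rewrite Finₚ.splitAt-↑ˡ h i h = refl

    swapHalves-ʳ : ∀ i → swapHalves (⇑ʳ i) ≡ ⇑ˡ i
    swapHalves-ʳ i rewrite Finₚ.splitAt-↑ʳ h h i = refl

    swapHalves-involutive : ∀ r → swapHalves (swapHalves r) ≡ r
    swapHalves-involutive r with splitAt h r in eq
    ... | inj₁ i = ≡.trans (swapHalves-ʳ i) (Finₚ.splitAt⁻¹-↑ˡ eq)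
    ... | inj₂ i = ≡.trans (swapHalves-ˡ i) (Finₚ.splitAt⁻¹-↑ʳ eq)

    swapHalves-injective : Injective _≡_ _≡_ swapHalves
    swapHalves-injective {r} {s} eq =
      ≡.trans (≡.sym (swapHalves-involutive r)) (≡.trans (cong swapHalves eq) (swapHalves-involutive s))

    -- M · [[I, 0], [−I, I]] and then [[I, 0], [I, I]] · (…) give [[X − Y, Y], [0, X + Y]];
    -- swapping the two halves moves the zero block to the upper right.
    det-blockCirculant : ∀ (M : Matrix (h ℕ.+ h)) (X Y : Matrix h)
      → (∀ i j → M (⇑ˡ i) (⇑ˡ j) ≈ X i j) → (∀ i j → M (⇑ˡ i) (⇑ʳ j) ≈ Y i j)
      → (∀ i j → M (⇑ʳ i) (⇑ˡ j) ≈ Y i j) → (∀ i j → M (⇑ʳ i) (⇑ʳ j) ≈ X i j)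
      → det (h ℕ.+ h) M ≈ det h (λ i j → X i j + Y i j) * det h (λ i j → X i j - Y i j)
    det-blockCirculant M X Y Mˡˡ Mˡʳ Mʳˡ Mʳʳ = begin
      det H M                            ≈⟨ *-identityʳ _ ⟨
      det H M * 1#                       ≈⟨ *-congˡ (det-scalarBlocks-unitriangular (- 1#)) ⟨
      det H M * det H colOp              ≈⟨ det-*M H M colOp ⟨
      det H MC                           ≈⟨ *-identityˡ _ ⟨
      1# * det H MC                      ≈⟨ *-congʳ (det-scalarBlocks-unitriangular 1#) ⟨
      det H rowOp * det H MC             ≈⟨ det-*M H rowOp MC ⟨
      det H U                            ≈⟨ det-reindex refl U swapHalves swapHalves-injective ⟨
      det H (λ r s → U (swapHalves r) (swapHalves s))
        ≈⟨ det-blockTriangular h h _ (λ i j →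
             ≡.subst₂ (λ x y → U x y ≈ 0#) (≡.sym (swapHalves-ˡ i)) (≡.sym (swapHalves-ʳ j)) (Uʳˡ i j)) ⟩
      det h (λ i j → U (swapHalves (⇑ˡ i)) (swapHalves (⇑ˡ j))) * det h (λ i j → U (swapHalves (⇑ʳ i)) (swapHalves (⇑ʳ j)))
        ≈⟨ *-cong (det-cong h λ i j → ≡.subst₂ (λ x y → U x y ≈ X i j + Y i j)
                                                (≡.sym (swapHalves-ˡ i)) (≡.sym (swapHalves-ˡ j)) (Uʳʳ i j))
                  (det-cong h λ i j → ≡.subst₂ (λ x y → U x y ≈ X i j - Y i j)
                                                (≡.sym (swapHalves-ʳ i)) (≡.sym (swapHalves-ʳ j)) (Uˡˡ i j)) ⟩
      det h (λ i j → X i j + Y i j) * det h (λ i j → X i j - Y i j)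
        ∎
      where
      H : ℕ
      H = h ℕ.+ h
      colOp rowOp MC U : Matrix H
      colOp = scalarBlocks 1# 0# (- 1#) 1#
      rowOp = scalarBlocks 1# 0# 1# 1#
      MC = M *M colOp
      U = rowOp *M MC
      *-1 : ∀ x → x * - 1# ≈ - x
      *-1 x = trans (*-comm _ _) (-1*x≈-x x)
      MCˡˡ : ∀ i j → MC (⇑ˡ i) (⇑ˡ j) ≈ X i j - Y i j
      MCˡˡ i j = trans (*M-scalarBlocks-ˡ 1# 0# (- 1#) 1# M _ j)
                       (+-cong (trans (*-identityʳ _) (Mˡˡ i j)) (trans (*-1 _) (-‿cong (Mˡʳ i j))))
      MCˡʳ : ∀ i j → MC (⇑ˡ i) (⇑ʳ j) ≈ Y i j
      MCˡʳ i j = trans (*M-scalarBlocks-ʳ 1# 0# (- 1#) 1# M _ j) (trans (+-cong (zeroʳ _) (*-identityʳ _)) (trans (+-identityˡ _) (Mˡʳ i j)))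
      MCʳˡ : ∀ i j → MC (⇑ʳ i) (⇑ˡ j) ≈ Y i j - X i j
      MCʳˡ i j = trans (*M-scalarBlocks-ˡ 1# 0# (- 1#) 1# M _ j)
                       (+-cong (trans (*-identityʳ _) (Mʳˡ i j)) (trans (*-1 _) (-‿cong (Mʳʳ i j))))
      MCʳʳ : ∀ i j → MC (⇑ʳ i) (⇑ʳ j) ≈ X i j
      MCʳʳ i j = trans (*M-scalarBlocks-ʳ 1# 0# (- 1#) 1# M _ j) (trans (+-cong (zeroʳ _) (*-identityʳ _)) (trans (+-identityˡ _) (Mʳʳ i j)))
      Uˡ : ∀ i s → U (⇑ˡ i) s ≈ MC (⇑ˡ i) s
      Uˡ i s = trans (scalarBlocks-*M-ˡ 1# 0# 1# 1# MC i s) (trans (+-cong (*-identityˡ _) (zeroˡ _)) (+-identityʳ _))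
      Uʳ : ∀ i s → U (⇑ʳ i) s ≈ MC (⇑ˡ i) s + MC (⇑ʳ i) s
      Uʳ i s = trans (scalarBlocks-*M-ʳ 1# 0# 1# 1# MC i s) (+-cong (*-identityˡ _) (*-identityˡ _))
      Uˡˡ : ∀ i j → U (⇑ˡ i) (⇑ˡ j) ≈ X i j - Y i j
      Uˡˡ i j = trans (Uˡ i (⇑ˡ j)) (MCˡˡ i j)
      Uʳˡ : ∀ i j → U (⇑ʳ i) (⇑ˡ j) ≈ 0#
      Uʳˡ i j = begin
        U (⇑ʳ i) (⇑ˡ j)                   ≈⟨ trans (Uʳ i (⇑ˡ j)) (+-cong (MCˡˡ i j) (MCʳˡ i j)) ⟩
        (X i j - Y i j) + (Y i j - X i j) ≈⟨ +-congˡ (⁻¹-anti-homo‿- (X i j) (Y i j)) ⟨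
        (X i j - Y i j) - (X i j - Y i j) ≈⟨ -‿inverseʳ _ ⟩
        0#                                ∎
      Uʳʳ : ∀ i j → U (⇑ʳ i) (⇑ʳ j) ≈ X i j + Y i j
      Uʳʳ i j = trans (Uʳ i (⇑ʳ j)) (trans (+-cong (MCˡʳ i j) (MCʳʳ i j)) (+-comm _ _))

module CharacteristicPolynomial where

  open Polynomial
  open PolynomialRing
  open Determinant commutativeRing using (Matrix; det; sgn; minor; laplaceTerm; det-cong)
  open import Algebra.Properties.Semiring.Sum (CommutativeRing.semiring commutativeRing) using (sum; sum-cong-≋)
  open ≋-Reasoning

  scaleP-sign : ∀ k p → scaleP (sign k) p ≋ sgn k *P p
  scaleP-sign zero    p = ≋-trans (scaleP-identity p) (≋-sym (*P-identityˡ p))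
  scaleP-sign (suc k) p = begin
    scaleP (ℚ.- sign k) p              ≈⟨ ≋-reflexive (cong (λ c → scaleP c p) (-1*x≈-x (sign k))) ⟨
    scaleP (ℚ.- 1ℚ ℚ.* sign k) p        ≈⟨ scaleP-scaleP (ℚ.- 1ℚ) (sign k) p ⟨
    -P scaleP (sign k) p                ≈⟨ scaleP-cong (ℚ.- 1ℚ) (scaleP-sign k p) ⟩
    -P (sgn k *P p)                     ≈⟨ scaleP-*P (ℚ.- 1ℚ) (sgn k) p ⟨
    (-P sgn k) *P p                     ∎
    where open import Algebra.Properties.Ring (CommutativeRing.ring ℚₚ.+-*-commutativeRing) using (-1*x≈-x)

  ΣP≋sum : ∀ n (f : Fin n → Poly) → ΣP n f ≋ sum f
  ΣP≋sum zero    f = ≋-refl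
  ΣP≋sum (suc n) f = +P-cong ≋-refl (ΣP≋sum n (f ∘ suc))

  Defs-det≋det : ∀ n (A : Matrix n) → Defs.det n A ≋ det n A
  Defs-det≋det zero    A = ≋-refl
  Defs-det≋det (suc n) A = ≋-trans (ΣP≋sum (suc n) λ j → scaleP (sign (toℕ j)) (A zero j *P Defs.det n (minor j A)))
    (sum-cong-≋ {suc n} λ j →
    ≋-trans (scaleP-sign (toℕ j) _) (*P-congʳ (sgn (toℕ j)) (*P-congʳ (A zero j) (Defs-det≋det n (minor j A)))))

  negArg-sum : ∀ n (f : Fin n → Poly) → negArg (sum f) ≋ sum (negArg ∘ f)
  negArg-sum zero    f = ≋-refl
  negArg-sum (suc n) f = ≋-trans (negArg-+P (f zero) _) (+P-cong ≋-refl (negArg-sum n (f ∘ suc)))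

  negArg-sgn : ∀ k → negArg (sgn k) ≋ sgn k
  negArg-sgn zero    = ≋-refl
  negArg-sgn (suc k) = ≋-trans (negArg-scaleP (ℚ.- 1ℚ) (sgn k)) (scaleP-cong (ℚ.- 1ℚ) (negArg-sgn k))

  negArg-det : ∀ n (A : Matrix n) → negArg (det n A) ≋ det n (λ i j → negArg (A i j))
  negArg-det zero    A = ≋-refl
  negArg-det (suc n) A = ≋-trans (negArg-sum (suc n) (laplaceTerm n A)) (sum-cong-≋ {suc n} λ j →
    ≋-trans (negArg-*P (sgn (toℕ j)) _) (*P-cong (negArg-sgn (toℕ j))
      (≋-trans (negArg-*P (A zero j) _) (*P-congʳ (negArg (A zero j)) (negArg-det n (minor j A))))))

  -- The entries of charPoly n M are local to a where clause of Defs; unifying with refl recovers them.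
  charMatrix : ∀ n → (Fin n → Fin n → ℚ) → Matrix n
  charMatrix n M = entries (charPoly n M) refl
    where
    entries : (p : Poly) {A : Matrix n} → p ≡ Defs.det n A → Matrix n
    entries _ {A} _ = A

  charMatrix-diag : ∀ n (M : Fin n → Fin n → ℚ) i → charMatrix n M i i ≡ ℚ.- M i i ∷ 1ℚ ∷ []
  charMatrix-diag n M i with i ≟ i
  ... | yes _  = refl
  ... | no i≢i = ⊥-elim (i≢i refl)

  charMatrix-offDiag : ∀ n (M : Fin n → Fin n → ℚ) {i j} → i ≢ j → charMatrix n M i j ≡ ℚ.- M i j ∷ []
  charMatrix-offDiag n M {i} {j} i≢j with i ≟ j
  ... | yes i≡j = ⊥-elim (i≢j i≡j)
  ... | no _    = refl

  charPoly≋det : ∀ n M → charPoly n M ≋ det n (charMatrix n M)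
  charPoly≋det n M = Defs-det≋det n (charMatrix n M)

module AdjacencyOperator where

  open import Algebra.Properties.Semiring.Sum (CommutativeRing.semiring ℚₚ.+-*-commutativeRing) using (sum)

  -- The summands of δ-entry, recovered as charMatrix recovers the entries of charPoly.
  δ-term : (G : WGraph) → Fin (nV G) → Fin (nV G) → Fin (nE G) → ℚ
  δ-term G u v = summands (δ-entry G u v) refl
    where
    summands : (x : ℚ) {f : Fin (nE G) → ℚ} → x ≡ ΣFin (nE G) f → Fin (nE G) → ℚ
    summands _ {f} _ = f

  ΣFin≡sum : ∀ n (f : Fin n → ℚ) → ΣFin n f ≡ sum f
  ΣFin≡sum zero    f = refl
  ΣFin≡sum (suc n) f = cong (f zero ℚ.+_) (ΣFin≡sum n (f ∘ suc))

  δ-entry≡sum : ∀ G u v → δ-entry G u v ≡ sum (δ-term G u v)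
  δ-entry≡sum G u v = ΣFin≡sum (nE G) (δ-term G u v)

  module _ (G : WGraph) {u v : Fin (nV G)} (e : Fin (nE G)) where

    δ-term-edge : t G e ≡ v → o G e ≡ u → δ-term G u v e ≡ ratio G v e
    δ-term-edge te≡v oe≡u with t G e ≟ v | o G e ≟ u
    ... | yes _    | yes _    = refl
    ... | no te≢v  | _        = ⊥-elim (te≢v te≡v)
    ... | yes _    | no oe≢u  = ⊥-elim (oe≢u oe≡u)

    δ-term-t≢ : t G e ≢ v → δ-term G u v e ≡ 0ℚ
    δ-term-t≢ te≢v with t G e ≟ v
    ... | yes te≡v = ⊥-elim (te≢v te≡v)
    ... | no _     = refl

    δ-term-o≢ : o G e ≢ u → δ-term G u v e ≡ 0ℚ
    δ-term-o≢ oe≢u with t G e ≟ v | o G e ≟ u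
    ... | yes _ | yes oe≡u = ⊥-elim (oe≢u oe≡u)
    ... | yes _ | no _     = refl
    ... | no _  | _        = refl

  ratio-cong : ∀ G H {v v′ e e′} → wV G v ≡ wV H v′ → wE G e ≡ wE H e′ → ratio G v e ≡ ratio H v′ e′
  ratio-cong G H {v} {v′} {e} {e′} = division-cong {{wE-pos G e}} {{wE-pos H e′}}
    where
    division-cong : ∀ {a a′ n n′ : ℕ} {{_ : ℕ.NonZero n}} {{_ : ℕ.NonZero n′}}
      → a ≡ a′ → n ≡ n′ → (+ a) ℚ./ n ≡ (+ a′) ℚ./ n′
    division-cong {n = suc _} refl refl = refl

module QuotientGraph (G : WGraph) (side : Fin (nV G) → Bool) (bipartite : Bipartite G side)
                     (τ : Involution G) (τ-swaps-sides : ∀ v → ¬ (side (τV τ v) ≡ side v))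
                     (G′ : WGraph) (quotient : IsQuotient G τ G′) where

  open IsQuotient quotient
  open AdjacencyOperator
  open Determinant ℚₚ.+-*-commutativeRing using (sum-zero; sum-reindex)
  open import Algebra.Properties.Semiring.Sum (CommutativeRing.semiring ℚₚ.+-*-commutativeRing) using (sum; sum-cong-≋)

  h : ℕ
  h = nV G′

  side-τ : ∀ v → side (τV τ v) ≡ not (side v)
  side-τ v = ¬-not (τ-swaps-sides v)

  τV-injective : Injective _≡_ _≡_ (τV τ)
  τV-injective {u} {w} eq = ≡.trans (≡.sym (τV-inv τ u)) (≡.trans (cong (τV τ) eq) (τV-inv τ w))

  t-τ : ∀ e → t G (τE τ e) ≡ τV τ (t G e)
  t-τ e = ≡.trans (cong (o G) (≡.sym (τ-bar τ e))) (τ-o τ (bar G e))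

  t-π : ∀ e → t G′ (πE e) ≡ πV (t G e)
  t-π e = ≡.trans (cong (o G′) (π-bar e)) (π-o (bar G e))

  πV-τ : ∀ v → πV (τV τ v) ≡ πV v
  πV-τ v = ≡.sym (Equivalence.from (πV-fib v (τV τ v)) (inj₂ refl))

  πE-τ : ∀ e → πE (τE τ e) ≡ πE e
  πE-τ e = ≡.sym (Equivalence.from (πE-fib e (τE τ e)) (inj₂ refl))

  πV-injective-on-sides : ∀ u w → side u ≡ side w → πV u ≡ πV w → u ≡ w
  πV-injective-on-sides u w same eq with Equivalence.to (πV-fib u w) eq
  ... | inj₁ w≡u  = ≡.sym w≡u
  ... | inj₂ w≡τu = ⊥-elim (τ-swaps-sides u (≡.trans (cong side (≡.sym w≡τu)) (≡.sym same)))

  πE-injective-on-sides : ∀ e f → side (t G e) ≡ side (t G f) → πE e ≡ πE f → e ≡ f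
  πE-injective-on-sides e f same eq with Equivalence.to (πE-fib e f) eq
  ... | inj₁ f≡e  = ≡.sym f≡e
  ... | inj₂ f≡τe = ⊥-elim (τ-swaps-sides (t G e)
          (≡.trans (cong side (≡.sym (≡.trans (cong (t G) f≡τe) (t-τ e)))) (≡.sym same)))

  toO : Fin (nV G) → Fin (nV G)
  toO v with side v
  ... | true  = v
  ... | false = τV τ v

  toO-side : ∀ v → side (toO v) ≡ true
  toO-side v with side v in eq
  ... | true  = eq
  ... | false = ≡.trans (side-τ v) (cong not eq)

  πV-toO : ∀ v → πV (toO v) ≡ πV v
  πV-toO v with side v
  ... | true  = refl
  ... | false = πV-τ v

  lift : Fin h → Fin (nV G)
  lift c = toO (proj₁ (πV-surj c))

  πV-lift : ∀ c → πV (lift c) ≡ c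
  πV-lift c = ≡.trans (πV-toO _) (proj₂ (πV-surj c))

  πV-τ-lift : ∀ c → πV (τV τ (lift c)) ≡ c
  πV-τ-lift c = ≡.trans (πV-τ (lift c)) (πV-lift c)

  lift-side : ∀ c → side (lift c) ≡ true
  lift-side c = toO-side _

  τ-lift-side : ∀ c → side (τV τ (lift c)) ≡ false
  τ-lift-side c = ≡.trans (side-τ (lift c)) (cong not (lift-side c))

  lift-injective : Injective _≡_ _≡_ lift
  lift-injective {a} {b} eq = ≡.trans (≡.sym (πV-lift a)) (≡.trans (cong πV eq) (πV-lift b))

  lift≢τ-lift : ∀ a b → lift a ≢ τV τ (lift b)
  lift≢τ-lift a b eq with ≡.trans (≡.sym (lift-side a)) (≡.trans (cong side eq) (τ-lift-side b))
  ... | ()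

  toOᴱ : Fin (nE G) → Fin (nE G)
  toOᴱ e with side (t G e)
  ... | true  = e
  ... | false = τE τ e

  toOᴱ-side : ∀ e → side (t G (toOᴱ e)) ≡ true
  toOᴱ-side e with side (t G e) in eq
  ... | true  = eq
  ... | false = ≡.trans (cong side (t-τ e)) (≡.trans (side-τ (t G e)) (cong not eq))

  πE-toOᴱ : ∀ e → πE (toOᴱ e) ≡ πE e
  πE-toOᴱ e with side (t G e)
  ... | true  = refl
  ... | false = πE-τ e

  liftᴱ : Fin (nE G′) → Fin (nE G)
  liftᴱ c = toOᴱ (proj₁ (πE-surj c))

  πE-liftᴱ : ∀ c → πE (liftᴱ c) ≡ c
  πE-liftᴱ c = ≡.trans (πE-toOᴱ _) (proj₂ (πE-surj c))

  liftᴱ-side : ∀ c → side (t G (liftᴱ c)) ≡ true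
  liftᴱ-side c = toOᴱ-side _

  liftᴱ-injective : Injective _≡_ _≡_ liftᴱ
  liftᴱ-injective {a} {b} eq = ≡.trans (≡.sym (πE-liftᴱ a)) (≡.trans (cong πE eq) (πE-liftᴱ b))

  δ-entry-same-side : ∀ u v → side u ≡ side v → δ-entry G u v ≡ 0ℚ
  δ-entry-same-side u v same = ≡.trans (δ-entry≡sum G u v) (sum-zero (nE G) λ e → no-edge e (t G e ≟ v) (o G e ≟ u))
    where
    no-edge : ∀ e → Dec (t G e ≡ v) → Dec (o G e ≡ u) → δ-term G u v e ≡ 0ℚ
    no-edge e (no te≢v)  _          = δ-term-t≢ G e te≢v
    no-edge e (yes _)    (no oe≢u)  = δ-term-o≢ G e oe≢u
    no-edge e (yes te≡v) (yes oe≡u) = ⊥-elim (bipartite e (≡.trans (cong side oe≡u) (≡.trans same (cong side (≡.sym te≡v)))))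

  δ-entry-τ : ∀ u v → δ-entry G (τV τ u) (τV τ v) ≡ δ-entry G u v
  δ-entry-τ u v = begin
    δ-entry G (τV τ u) (τV τ v)              ≡⟨ δ-entry≡sum G _ _ ⟩
    sum (δ-term G (τV τ u) (τV τ v))         ≡⟨ sum-reindex (nE G) (nE G) (τE τ) (τE τ) _ τE-injective
                                                  (λ e ττe≢e → ⊥-elim (ττe≢e (τE-inv τ e))) ⟨
    sum (δ-term G (τV τ u) (τV τ v) ∘ τE τ)  ≡⟨ sum-cong-≋ {nE G} (λ e → τ-term e (t G e ≟ v) (o G e ≟ u)) ⟩
    sum (δ-term G u v)                       ≡⟨ δ-entry≡sum G u v ⟨
    δ-entry G u v                            ∎
    where
    open ≡.≡-Reasoning
    τE-injective : Injective _≡_ _≡_ (τE τ)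
    τE-injective {a} {b} eq = ≡.trans (≡.sym (τE-inv τ a)) (≡.trans (cong (τE τ) eq) (τE-inv τ b))
    τ-term : ∀ e → Dec (t G e ≡ v) → Dec (o G e ≡ u) → δ-term G (τV τ u) (τV τ v) (τE τ e) ≡ δ-term G u v e
    τ-term e (yes te≡v) (yes oe≡u) = begin
      δ-term G (τV τ u) (τV τ v) (τE τ e) ≡⟨ δ-term-edge G (τE τ e) (≡.trans (t-τ e) (cong (τV τ) te≡v))
                                                                     (≡.trans (τ-o τ e) (cong (τV τ) oe≡u)) ⟩
      ratio G (τV τ v) (τE τ e)           ≡⟨ ratio-cong G G (τ-wV τ v) (τ-wE τ e) ⟩
      ratio G v e                         ≡⟨ δ-term-edge G e te≡v oe≡u ⟨
      δ-term G u v e                      ∎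
    τ-term e (no te≢v) _ = ≡.trans (δ-term-t≢ G (τE τ e) (te≢v ∘ τV-injective ∘ ≡.trans (≡.sym (t-τ e))))
                                   (≡.sym (δ-term-t≢ G e te≢v))
    τ-term e (yes _) (no oe≢u) = ≡.trans (δ-term-o≢ G (τE τ e) (oe≢u ∘ τV-injective ∘ ≡.trans (≡.sym (τ-o τ e))))
                                         (≡.sym (δ-term-o≢ G e oe≢u))

  -- The edges of G′ into c are the images of the edges of G into lift c, all of which start in
  -- the τ-image of a lift.
  δ-entry-quotient : ∀ r c → δ-entry G′ r c ≡ δ-entry G (τV τ (lift r)) (lift c)
  δ-entry-quotient r c = begin
    δ-entry G′ r c                ≡⟨ δ-entry≡sum G′ r c ⟩
    sum (δ-term G′ r c)           ≡⟨ sum-cong-≋ {nE G′} (λ e′ → ≡.subst (λ x → δ-term G′ r c x ≡ f (liftᴱ e′)) (πE-liftᴱ e′)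
                                       (lifted-term (liftᴱ e′) (liftᴱ-side e′) (t G (liftᴱ e′) ≟ lift c)
                                                    (o G (liftᴱ e′) ≟ τV τ (lift r)))) ⟩
    sum (f ∘ liftᴱ)               ≡⟨ sum-reindex (nE G′) (nE G) liftᴱ πE f liftᴱ-injective
                                       (λ e ne → off-O e ne (t G e ≟ lift c)) ⟩
    sum f                         ≡⟨ δ-entry≡sum G _ _ ⟨
    δ-entry G (τV τ (lift r)) (lift c) ∎
    where
    open ≡.≡-Reasoning
    f : Fin (nE G) → ℚ
    f = δ-term G (τV τ (lift r)) (lift c)
    lifted-term : ∀ e → side (t G e) ≡ true → Dec (t G e ≡ lift c) → Dec (o G e ≡ τV τ (lift r)) → δ-term G′ r c (πE e) ≡ f e
    lifted-term e _ (yes te≡) (yes oe≡) = begin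
      δ-term G′ r c (πE e)   ≡⟨ δ-term-edge G′ (πE e) (≡.trans (t-π e) (≡.trans (cong πV te≡) (πV-lift c)))
                                                    (≡.trans (π-o e) (≡.trans (cong πV oe≡) (πV-τ-lift r))) ⟩
      ratio G′ c (πE e)      ≡⟨ ratio-cong G′ G (≡.trans (cong (wV G′) (≡.sym (πV-lift c))) (π-wV (lift c))) (π-wE e) ⟩
      ratio G (lift c) e     ≡⟨ δ-term-edge G e te≡ oe≡ ⟨
      f e                    ∎
    lifted-term e te∈O (no te≢) _ = ≡.trans (δ-term-t≢ G′ (πE e) λ eq → te≢ (πV-injective-on-sides _ _
                                       (≡.trans te∈O (≡.sym (lift-side c)))
                                       (≡.trans (≡.sym (t-π e)) (≡.trans eq (≡.sym (πV-lift c))))))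
                                     (≡.sym (δ-term-t≢ G e te≢))
    lifted-term e te∈O (yes _) (no oe≢) = ≡.trans (δ-term-o≢ G′ (πE e) λ eq → oe≢ (πV-injective-on-sides _ _
                                       (≡.trans oe∉O (≡.sym (τ-lift-side r)))
                                       (≡.trans (≡.sym (π-o e)) (≡.trans eq (≡.sym (πV-τ-lift r))))))
                                     (≡.sym (δ-term-o≢ G e oe≢))
      where
      oe∉O : side (o G e) ≡ false
      oe∉O = ≡.trans (¬-not (bipartite e)) (cong not te∈O)
    off-O : ∀ e → liftᴱ (πE e) ≢ e → Dec (t G e ≡ lift c) → f e ≡ 0ℚ
    off-O e _  (no te≢) = δ-term-t≢ G e te≢
    off-O e ne (yes te≡) = ⊥-elim (ne (πE-injective-on-sides _ _
      (≡.trans (liftᴱ-side (πE e)) (≡.sym (≡.trans (cong side te≡) (lift-side c)))) (πE-liftᴱ (πE e))))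

  order : Fin (h ℕ.+ h) → Fin (nV G)
  order r = [ lift , τV τ ∘ lift ]′ (splitAt h r)

  order-ˡ : ∀ i → order (i ↑ˡ h) ≡ lift i
  order-ˡ i rewrite Finₚ.splitAt-↑ˡ h i h = refl

  order-ʳ : ∀ i → order (h ↑ʳ i) ≡ τV τ (lift i)
  order-ʳ i rewrite Finₚ.splitAt-↑ʳ h h i = refl

  order-injective : Injective _≡_ _≡_ order
  order-injective {r} {s} eq with splitAt h r in eqr | splitAt h s in eqs
  ... | inj₁ i | inj₁ j = ≡.trans (≡.sym (Finₚ.splitAt⁻¹-↑ˡ eqr))
                            (≡.trans (cong (_↑ˡ h) (lift-injective eq)) (Finₚ.splitAt⁻¹-↑ˡ eqs))
  ... | inj₁ i | inj₂ j = ⊥-elim (lift≢τ-lift i j eq)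
  ... | inj₂ i | inj₁ j = ⊥-elim (lift≢τ-lift j i (≡.sym eq))
  ... | inj₂ i | inj₂ j = ≡.trans (≡.sym (Finₚ.splitAt⁻¹-↑ʳ eqr))
                            (≡.trans (cong (h ↑ʳ_) (lift-injective (τV-injective eq))) (Finₚ.splitAt⁻¹-↑ʳ eqs))

  h+h≡nV : h ℕ.+ h ≡ nV G
  h+h≡nV = Finₚ.cantor-schröder-bernstein order-injective position-injective
    where
    position : Fin (nV G) → Fin (h ℕ.+ h)
    position v with side v
    ... | true  = πV v ↑ˡ h
    ... | false = h ↑ʳ πV v
    position-injective : Injective _≡_ _≡_ position
    position-injective {v} {w} eq with side v in ev | side w in ew
    ... | true  | true  = πV-injective-on-sides v w (≡.trans ev (≡.sym ew)) (Finₚ.↑ˡ-injective h _ _ eq)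
    ... | true  | false = ⊥-elim (FinProperties.↑ˡ≢↑ʳ _ _ eq)
    ... | false | true  = ⊥-elim (FinProperties.↑ˡ≢↑ʳ _ _ (≡.sym eq))
    ... | false | false = πV-injective-on-sides v w (≡.trans ev (≡.sym ew)) (Finₚ.↑ʳ-injective h _ _ eq)

  open Polynomial
  open PolynomialRing
  open CharacteristicPolynomial
  open Determinant commutativeRing using (Matrix; det; sgn; det-cong; det-reindex; det-negate; module Blocks)

  A : Fin h → Fin h → ℚ
  A = δ-entry G′

  x-if : ∀ {p} {P : Set p} → Dec P → Poly
  x-if (yes _) = 0ℚ ∷ 1ℚ ∷ []
  x-if (no _)  = []

  X Y : Matrix h
  X i j = x-if (i ≟ j)
  Y i j = ℚ.- A i j ∷ []

  B : Matrix (h ℕ.+ h)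
  B r s = charMatrix (nV G) (δ-entry G) (order r) (order s)

  diagonal-block : (ℓ : Fin h → Fin (nV G)) → Injective _≡_ _≡_ ℓ → (∀ i j → side (ℓ i) ≡ side (ℓ j))
    → ∀ i j → charMatrix (nV G) (δ-entry G) (ℓ i) (ℓ j) ≋ X i j
  diagonal-block ℓ ℓ-injective same i j with i ≟ j
  ... | yes refl = ≋-trans (≋-reflexive (charMatrix-diag _ _ (ℓ i)))
                           (∷-cong (cong ℚ.-_ (δ-entry-same-side _ _ (same i i))) ≋-refl)
  ... | no i≢j   = ≋-trans (≋-reflexive (charMatrix-offDiag _ _ (i≢j ∘ ℓ-injective)))
                           (≋-trans (∷-cong (cong ℚ.-_ (δ-entry-same-side _ _ (same i j))) ≋-refl) 0∷[]≋[])

  δ-entry-across : ∀ i j → δ-entry G (lift i) (τV τ (lift j)) ≡ A i j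
  δ-entry-across i j = ≡.trans (≡.sym (δ-entry-τ (lift i) (τV τ (lift j))))
    (≡.trans (cong (δ-entry G (τV τ (lift i))) (τV-inv τ (lift j))) (≡.sym (δ-entry-quotient i j)))

  B-ˡˡ : ∀ i j → B (i ↑ˡ h) (j ↑ˡ h) ≋ X i j
  B-ˡˡ i j = ≡.subst₂ (λ u w → charMatrix (nV G) (δ-entry G) u w ≋ X i j) (≡.sym (order-ˡ i)) (≡.sym (order-ˡ j))
    (diagonal-block lift (lift-injective) (λ a b → ≡.trans (lift-side a) (≡.sym (lift-side b))) i j)

  B-ʳʳ : ∀ i j → B (h ↑ʳ i) (h ↑ʳ j) ≋ X i j
  B-ʳʳ i j = ≡.subst₂ (λ u w → charMatrix (nV G) (δ-entry G) u w ≋ X i j) (≡.sym (order-ʳ i)) (≡.sym (order-ʳ j))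
    (diagonal-block (τV τ ∘ lift) (lift-injective ∘ τV-injective) (λ a b → ≡.trans (τ-lift-side a) (≡.sym (τ-lift-side b))) i j)

  B-ˡʳ : ∀ i j → B (i ↑ˡ h) (h ↑ʳ j) ≋ Y i j
  B-ˡʳ i j = ≡.subst₂ (λ u w → charMatrix (nV G) (δ-entry G) u w ≋ Y i j) (≡.sym (order-ˡ i)) (≡.sym (order-ʳ j))
    (≋-reflexive (≡.trans (charMatrix-offDiag _ _ (lift≢τ-lift i j)) (cong (λ a → ℚ.- a ∷ []) (δ-entry-across i j))))

  B-ʳˡ : ∀ i j → B (h ↑ʳ i) (j ↑ˡ h) ≋ Y i j
  B-ʳˡ i j = ≡.subst₂ (λ u w → charMatrix (nV G) (δ-entry G) u w ≋ Y i j) (≡.sym (order-ʳ i)) (≡.sym (order-ˡ j))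
    (≋-reflexive (≡.trans (charMatrix-offDiag _ _ (lift≢τ-lift j i ∘ ≡.sym))
                          (cong (λ a → ℚ.- a ∷ []) (≡.sym (δ-entry-quotient i j)))))

  X+Y≋charMatrix : ∀ i j → X i j +P Y i j ≋ charMatrix h A i j
  X+Y≋charMatrix i j with i ≟ j
  ... | yes refl = ∷-cong (ℚₚ.+-identityˡ _) ≋-refl
  ... | no _     = ≋-refl

  X-Y≋-negArg-charMatrix : ∀ i j → X i j +P -P Y i j ≋ -P negArg (charMatrix h A i j)
  X-Y≋-negArg-charMatrix i j with i ≟ j
  ... | yes refl = ∷-cong (ℚₚ.+-identityˡ _) ≋-refl
  ... | no _     = ≋-refl

  χδ-factorisation : χδ G ≋ scaleP (sign h) (χδ G′ *P negArg (χδ G′))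
  χδ-factorisation = begin
    χδ G
      ≈⟨ charPoly≋det (nV G) (δ-entry G) ⟩
    det (nV G) (charMatrix (nV G) (δ-entry G))
      ≈⟨ det-reindex h+h≡nV _ order order-injective ⟨
    det (h ℕ.+ h) B
      ≈⟨ Blocks.det-blockCirculant h B X Y B-ˡˡ B-ˡʳ B-ʳˡ B-ʳʳ ⟩
    det h (λ i j → X i j +P Y i j) *P det h (λ i j → X i j +P -P Y i j)
      ≈⟨ *P-cong (det-cong h X+Y≋charMatrix) (det-cong h X-Y≋-negArg-charMatrix) ⟩
    det h (charMatrix h A) *P det h (λ i j → -P negArg (charMatrix h A i j))
      ≈⟨ *P-congʳ (det h (charMatrix h A)) (det-negate h _) ⟩
    det h (charMatrix h A) *P (sgn h *P det h (λ i j → negArg (charMatrix h A i j)))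
      ≈⟨ *P-cong (charPoly≋det h A) (*P-congʳ (sgn h) (≋-trans (negArg-cong (charPoly≋det h A)) (negArg-det h _))) ⟨
    χδ G′ *P (sgn h *P negArg (χδ G′))
      ≈⟨ x∙yz≈y∙xz (χδ G′) (sgn h) _ ⟩
    sgn h *P (χδ G′ *P negArg (χδ G′))
      ≈⟨ scaleP-sign h _ ⟨
    scaleP (sign h) (χδ G′ *P negArg (χδ G′))
      ∎
    where
    open ≋-Reasoning
    open import Algebra.Properties.CommutativeSemigroup (CommutativeRing.*-commutativeSemigroup commutativeRing) using (x∙yz≈y∙xz)

lemma2p4 : (G : WGraph) (N : ℕ) (side : Fin (nV G) → Bool)
    → Connected G → Regular G N → Bipartite G side
    → (τ : Involution G) → NonTrivial τ
    → (∀ v → ¬ (side (τV τ v) ≡ side v))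
    → (G' : WGraph) → IsQuotient G τ G'
    → χδ G ≈P (scaleP (sign (nV G')) (χδ G' *P negArg (χδ G')))
lemma2p4 G _ side _ _ bipartite τ _ τ-swaps-sides G' quotient =
  Polynomial.coeff-≡ (QuotientGraph.χδ-factorisation G side bipartite τ τ-swaps-sides G' quotient)
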